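{- Let $H$ be a finite $k$-graph, $v \in V(H)$, fix a linear ordering $\prec$ of $V(H)$, let $T = T(H,v)$ be the $k$-walk-tree of $H$ rooted at $v$ and $V = (v)$. Let $E_1, \dots, E_m$ be the edges of $T$ containing $V$, with $E_i = \{V, U_{(i,1)}, \dots, U_{(i,k-1)}\}$ for each $i \in [m]$. Then $$\mathcal{P}_H(\overline{v}) = \mathcal{P}_T(\overline{V}) = \frac{1}{1 + \sum_{i\in [m]}\prod_{j\in [k-1]}\mathcal{P}_{T(U_{(i,j)})}\left(\overline{U_{(i,j)}}\right)}.$$
   Context: A $k$-graph is a $k$-uniform hypergraph. For a finite $k$-graph $G$, let $M$ be a matching (set of pairwise vertex-disjoint edges, the empty one included) chosen uniformly at random among all matchings of $G$; $\mathcal{P}_G(\overline{u})$ is the probability that no edge of $M$ contains $u$. A Berge-path is a sequence $(v_0, e_1, v_1, \dots, e_\ell, v_\ell)$ of distinct vertices and distinct edges with $v_{i-1}, v_i \in e_i$. Given $\prec$, for $\ell\ge1$ write $e_i = \{v_{i-1}, u_{(i,1)}, \dots, u_{(i,k-2)}, v_i\}$ and $C_i = \{u_{(i,j)} : u_{(i,j)} \prec v_i, j\in[k-2]\} \cup \{v_{i-1}\}$; the Berge-path is a conflict-free walk if for each $2 \le i \le \ell$, $e_i$ is disjoint from $\bigcup_{j<i} C_j$; the one-vertex sequence $(v)$ is also a conflict-free walk. The $k$-walk-tree $T(H,v)$ has as vertices the conflict-free walks starting at $v$, and $W_0,\dots,W_{k-1}$ form an edge whenever there is $e = \{u_0,\dots,u_{k-1}\}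 \in E(H)$ such that $W_0$ ends at $u_0$ and each $W_i$ ($i\in[k-1]$) is obtained from $W_0$ by appending $e$ and then $u_i$. $T(H,v)$ is a $k$-uniform hypertree rooted at $V=(v)$. For a vertex $U$ of $T$, $T(U)$ denotes the sub-hypertree of $T$ rooted at $U$: the sub-hypergraph of $T$ induced on the conflict-free walks that have $U$ as an initial segment (i.e. $U$ and its descendants), with all edges of $T$ contained in this set. -}

module Defs where

open import Level using (0ℓ)
open import Data.Bool using (Bool; true; false; _∧_; _∨_; not; if_then_else_)
open import Data.Bool.Properties using () renaming (_≟_ to _≟ᵇ_)
open import Data.Nat as ℕ using (ℕ; zero; suc; _≤_; _+_)
open import Data.Nat.Properties as ℕP using (≤-trans; m≤m+n)
open import Data.Integer using (+_)
open import Data.Rational as ℚ using (ℚ; 0ℚ; 1ℚ; 1/_)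
open import Data.Rational.Properties using () renaming (_≟_ to _≟ℚ_)
open import Data.Fin using (Fin)
open import Data.Fin.Subset using (Subset; inside; outside; ∣_∣) renaming (_∈_ to _∈ₛ_)
open import Data.Vec using (lookup)
open import Data.Vec.Properties as VecP using ()
open import Data.List using (List; []; _∷_; _++_; map; filter; length; allFin; [_]; foldr)
open import Data.List.Properties as ListP using ()
open import Data.List.Membership.Propositional using () renaming (_∈_ to _∈ₗ_)
open import Data.List.Relation.Unary.All using (All)
open import Data.List.Relation.Unary.Unique.Propositional using (Unique)
open import Data.Product using (Σ; _×_; _,_; proj₁; proj₂)
open import Data.Product.Properties as ProdP using ()
open import Data.Sum using (_⊎_)
open import Data.Unit using (⊤)
open import Data.Empty using (⊥)
open import Relation.Binary using (Rel; IsStrictTotalOrder)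
open import Relation.Binary.Definitions using (DecidableEquality)
open import Relation.Binary.PropositionalEquality using (_≡_; _≢_; refl; sym)
open import Relation.Nullary using (¬_; does; yes; no)
open import Function using (_⇔_)

-- Distinct
-- list entries are distinct edges (the statement imposes 'Unique' on the
-- edge lists it uses).  A matching is a set of edges, i.e. a sublist
-- (choice of positions) of the edge list, whose edges are pairwise
-- vertex-disjoint (the empty one included).

anyᵇ : ∀ {a} {X : Set a} → (X → Bool) → List X → Bool
anyᵇ p []       = false
anyᵇ p (x ∷ xs) = p x ∨ anyᵇ p xs

allᵇ : ∀ {a} {X : Set a} → (X → Bool) → List X → Bool
allᵇ p []       = true
allᵇ p (x ∷ xs) = p x ∧ allᵇ p xs

sublists : ∀ {a} {X : Set a} → List X → List (List X)
sublists []       = [] ∷ []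
sublists (x ∷ xs) = sublists xs ++ map (x ∷_) (sublists xs)

count : ∀ {a} {X : Set a} → (X → Bool) → List X → ℕ
count p []       = 0
count p (x ∷ xs) = (if p x then 1 else 0) + count p xs

count-++ : ∀ {a} {X : Set a} (p : X → Bool) (xs ys : List X) →
           count p (xs ++ ys) ≡ count p xs + count p ys
count-++ p []       ys = refl
count-++ p (x ∷ xs) ys rewrite count-++ p xs ys =
  sym (ℕP.+-assoc (if p x then 1 else 0) (count p xs) (count p ys))

1≤count-sublists : ∀ {a} {X : Set a} (p : List X → Bool) → p [] ≡ true →
                   (xs : List X) → 1 ≤ count p (sublists xs)
1≤count-sublists p p[] [] rewrite p[] = ℕ.s≤s ℕ.z≤n
1≤count-sublists p p[] (x ∷ xs)
  rewrite count-++ p (sublists xs) (map (x ∷_) (sublists xs)) =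
  ≤-trans (1≤count-sublists p p[] xs) (m≤m+n _ _)

module Matchings {V E : Set} (_≟_ : DecidableEquality V) (verts : E → List V) where

  _∈ᵇ_ : V → List V → Bool
  u ∈ᵇ xs = anyᵇ (λ x → does (u ≟ x)) xs

  disjointᵇ : E → E → Bool
  disjointᵇ e f = allᵇ (λ x → not (x ∈ᵇ verts f)) (verts e)

  isMatching : List E → Bool
  isMatching []       = true
  isMatching (e ∷ es) = allᵇ (disjointᵇ e) es ∧ isMatching es

  avoids : V → List E → Bool
  avoids u M = allᵇ (λ e → not (u ∈ᵇ verts e)) M

  #matchings : List E → ℕ
  #matchings es = count isMatching (sublists es)

  #avoiding : List E → V → ℕ
  #avoiding es u = count (λ M → isMatching M ∧ avoids u M) (sublists es)

  #matchings-nonZero : (es : List E) → ℕ.NonZero (#matchings es)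
  #matchings-nonZero es = ℕ.>-nonZero (1≤count-sublists isMatching refl es)

  Prob : List E → V → ℚ
  Prob es u = ℚ._/_ (+ #avoiding es u) (#matchings es) {{#matchings-nonZero es}}

-- Total reciprocal on ℚ (agrees with 1/_ on non-zero arguments; its value
-- at 0 is irrelevant for the statement, where the argument is ≥ 1).

inv : ℚ → ℚ
inv p with p ≟ℚ 0ℚ
... | yes _  = 0ℚ
... | no p≢0 = 1/_ p {{ℚ.≢-nonZero p≢0}}

sumℚ : List ℚ → ℚ
sumℚ = foldr ℚ._+_ 0ℚ

prodℚ : List ℚ → ℚ
prodℚ = foldr ℚ._*_ 1ℚ

module _ {n : ℕ} where

  members : Subset n → List (Fin n)
  members s = filter (λ i → lookup s i ≟ᵇ true) (allFin n)

  _≟V_ : DecidableEquality (Fin n)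
  _≟V_ = Data.Fin._≟_

  _≟S_ : DecidableEquality (Subset n)
  _≟S_ = VecP.≡-dec _≟ᵇ_

record KGraph (k n : ℕ) : Set where
  field
    edges    : List (Subset n)
    distinct : Unique edges
    uniform  : All (λ e → ∣ e ∣ ≡ k) edges
open KGraph public

-- Walks.  A walk (v₀ , [(e₁ , v₁) , … , (e_ℓ , v_ℓ)]) represents the
-- sequence (v₀, e₁, v₁, …, e_ℓ, v_ℓ).

Walk : ℕ → Set
Walk n = Fin n × List (Subset n × Fin n)

_≟W_ : ∀ {n} → DecidableEquality (Walk n)
_≟W_ = ProdP.≡-dec _≟V_ (ListP.≡-dec (ProdP.≡-dec _≟S_ _≟V_))

endW : ∀ {n} → Walk n → Fin n
endW (v , st) = go v st
  where
  go : _ → List (_ × _) → _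
  go v []             = v
  go v ((e , w) ∷ st) = go w st

_⊕_ : ∀ {n} → Walk n → Subset n × Fin n → Walk n
(v , st) ⊕ eu = (v , st ++ [ eu ])

isPrefixᵇ : ∀ {n} → Walk n → Walk n → Bool
isPrefixᵇ (u , su) (w , sw) = does (u ≟V w) ∧ go su sw
  where
  go : _ → _ → Bool
  go []       _        = true
  go (_ ∷ _)  []       = false
  go (x ∷ xs) (y ∷ ys) = does (ProdP.≡-dec _≟S_ _≟V_ x y) ∧ go xs ys

module WalkTree {k n : ℕ} (H : KGraph k n) (_≺_ : Rel (Fin n) 0ℓ) where

  InC : Subset n → Fin n → Fin n → Fin n → Set
  InC e a b u = (u ∈ₛ e × u ≢ a × u ≢ b × u ≺ b) ⊎ u ≡ a

  -- CF prev Cs vs es steps : the remaining steps form, together with the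
  -- already traversed part (last vertex prev, visited vertices vs, used
  -- edges es, union Cs of the C_j so far), a conflict-free walk:
  -- each new edge e_i is an edge of H, contains v_{i-1} and v_i, is not
  -- yet used, v_i is new, and e_i is disjoint from ⋃_{j<i} C_j.
  CF : Fin n → (Fin n → Set) → List (Fin n) → List (Subset n) →
       List (Subset n × Fin n) → Set
  CF prev Cs vs es []               = ⊤
  CF prev Cs vs es ((e , w) ∷ rest) =
    e ∈ₗ edges H × prev ∈ₛ e × w ∈ₛ e ×
    ¬ (w ∈ₗ vs) × ¬ (e ∈ₗ es) ×
    (∀ u → u ∈ₛ e → ¬ Cs u) ×
    CF w (λ u → Cs u ⊎ InC e prev w u) (w ∷ vs) (e ∷ es) rest

  IsCFW : Fin n → Walk n → Set
  IsCFW v (v₀ , st) = v₀ ≡ v × CF v₀ (λ _ → ⊥) (v₀ ∷ []) [] st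

  -- An edge of T(H,v) is generated by a pair (W₀ , e): W₀ a vertex of T
  -- ending at u₀ ∈ e ∈ E(H), such that every W₀ ⊕ (e , uᵢ) (uᵢ ∈ e ∖ {u₀})
  -- is a vertex of T.
  TEdge : Set
  TEdge = Walk n × Subset n

  IsTEdge : Fin n → TEdge → Set
  IsTEdge v (W₀ , e) =
    IsCFW v W₀ × e ∈ₗ edges H × endW W₀ ∈ₛ e ×
    (∀ u → u ∈ₛ e → u ≢ endW W₀ → IsCFW v (W₀ ⊕ (e , u)))

  tverts : TEdge → List (Walk n)
  tverts (W₀ , e) =
    W₀ ∷ map (λ u → W₀ ⊕ (e , u))
             (filter (λ u → Relation.Nullary.¬? (u ≟V endW W₀)) (members e))

  open Matchings {Walk n} {TEdge} _≟W_ tverts public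
    renaming (Prob to ProbT; _∈ᵇ_ to _∈ᵂ_)

  subtree : List TEdge → Walk n → List TEdge
  subtree ET U = filter (λ E → allᵇ (isPrefixᵇ U) (tverts E) ≟ᵇ true) ET

  rhs : List TEdge → Walk n → ℚ
  rhs ET V =
    inv (1ℚ ℚ.+ sumℚ (map (λ E → prodℚ (map (λ U → ProbT (subtree ET U) U)
                                             (filter (λ U → Relation.Nullary.¬? (U ≟W V)) (tverts E))))
                           (filter (λ E → V ∈ᵂ tverts E ≟ᵇ true) ET)))


ProbH : ∀ {k n} → KGraph k n → Fin n → ℚ
ProbH H u = Matchings.Prob _≟V_ members (edges H) u

-- Write M(G) for the number of matchings of G. A matching either misses x or covers it by exactly
-- one edge e ∋ x, so M(G) = M(G − x) + Σ_{e ∋ x} M(G − e), that is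
--   P_G(x̄) = 1 / (1 + Σ_{e ∋ x} M(G − e) / M(G − x)).
-- In the walk tree, for an edge E at W the forest T(W) − W is the disjoint union of the subtrees
-- T(U), U ∈ E ∖ {W}, and of the edges outside them, while T(W) − E is the same union with each
-- T(U) replaced by T(U) − U; the common part cancels and M(T(W) − E) / M(T(W) − W) = Π_U P_{T(U)}(Ū),
-- which is the second equality. In H, listing e ∖ {x} in ≺-order, M(G − e) / M(G − x) telescopes
-- into Π_u P_{G_u}(ū), where G_u is G − x minus the vertices of e preceding u. Starting from G = H,
-- G_u consists exactly of the edges avoiding the sets C_i of the conflict-free walk extended along e
-- to u, so induction on the number of such edges identifies P_H(v̄) with P_T(V̄).

module Submission where

open import Algebra.Bundles using (CommutativeMonoid)
open import Data.Bool using (Bool; true; false; _∧_; _∨_; not; if_then_else_)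
open import Data.Bool.Properties
  using (∧-assoc; ∧-comm; ∧-identityʳ; ∧-zeroʳ; ∨-identityʳ; ∨-zeroʳ; ∨-assoc) renaming (_≟_ to _≟ᵇ_)
open import Data.Empty using (⊥; ⊥-elim)
open import Data.Fin using (Fin)
open import Data.Fin.Subset using (Subset) renaming (_∈_ to _∈ₛ_)
import Data.Integer as ℤ
import Data.Integer.Properties as ℤP
open import Data.List using (List; []; _∷_; _++_; map; filter; length; allFin)
import Data.List.Properties as LP
open import Data.List.Membership.Propositional using (_∈_)
import Data.List.Membership.Propositional.Properties as MP
open import Data.List.Membership.Propositional.Properties.WithK using (unique∧set⇒bag)
open import Data.List.Relation.Binary.BagAndSetEquality using (∼bag⇒↭)
open import Data.List.Relation.Binary.Permutation.Propositional using (_↭_; ↭⇒↭ₛ)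
open import Data.List.Relation.Binary.Permutation.Propositional.Properties using () renaming (map⁺ to ↭-map⁺)
open import Data.List.Relation.Binary.Permutation.Setoid.Properties using (foldr-commMonoid)
import Data.List.Relation.Unary.All as All
open import Data.List.Relation.Unary.AllPairs using (_∷_)
open import Data.List.Relation.Unary.Any using (here; there)
import Data.List.Relation.Unary.Any as Any
open import Data.List.Relation.Unary.Unique.Propositional using (Unique)
import Data.List.Relation.Unary.Unique.Propositional.Properties as Uniqueₚ
open import Data.Nat as ℕ using (ℕ; suc; _+_; _*_; _≤_; _<_)
open import Data.Nat.Induction using (<-wellFounded)
open import Data.Nat.ListAction using (sum; product)
import Data.Nat.Properties as NP
open import Data.Product using (Σ; _×_; _,_; proj₁; proj₂)
open import Data.Product.Properties using (×-≡,≡←≡) renaming (≡-dec to ×-≡-dec)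
open import Data.Rational as ℚ using (ℚ; 0ℚ; 1ℚ; _/_; 1/_)
import Data.Rational.Properties as ℚP
open import Data.Rational.Solver using (module +-*-Solver)
open import Data.Rational.Unnormalised using (mkℚᵘ; *≡*)
import Data.Rational.Unnormalised.Properties as ℚᵘP
open import Data.Sum using (_⊎_; inj₁; inj₂; [_,_]′) renaming (map to ⊎-map)
open import Data.Unit using (tt)
open import Data.Vec using (lookup)
import Data.Vec.Properties as VecP
open import Function using (case_of_)
open import Function.Bundles using (_⇔_; Equivalence; mk⇔)
open import Induction.WellFounded using (Acc; acc)
open import Level using (0ℓ)
open import Relation.Binary using (Rel; IsStrictTotalOrder)
open import Relation.Binary.Definitions using (DecidableEquality; tri<; tri≈; tri>)
open import Relation.Binary.PropositionalEquality
  using (_≡_; _≢_; refl; sym; trans; cong; cong₂; subst; module ≡-Reasoning)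
open import Relation.Nullary using (¬_; ¬?; yes; no; does)
open import Relation.Nullary.Decidable using (dec-true)

open import Algebra.Properties.CommutativeSemigroup NP.+-commutativeSemigroup
  using () renaming (interchange to +-interchange)
open +-*-Solver using (solve; _:+_; _:*_; _:=_)

open import Defs

filterᵇ : ∀ {a} {X : Set a} → (X → Bool) → List X → List X
filterᵇ b = filter (λ x → b x ≟ᵇ true)

bool-ext : {b c : Bool} → (b ≡ true → c ≡ true) → (c ≡ true → b ≡ true) → b ≡ c
bool-ext {true}  {true}  _ _ = refl
bool-ext {true}  {false} f _ = sym (f refl)
bool-ext {false} {true}  _ g = g refl
bool-ext {false} {false} _ _ = refl

∧-true⁺ : ∀ {a b : Bool} → a ≡ true → b ≡ true → a ∧ b ≡ true
∧-true⁺ refl refl = refl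

∧-true⁻ : ∀ {a b : Bool} → a ∧ b ≡ true → a ≡ true × b ≡ true
∧-true⁻ {true} {true} _ = refl , refl

∨-true⁻ : ∀ {a b : Bool} → a ∨ b ≡ true → a ≡ true ⊎ b ≡ true
∨-true⁻ {true}  _ = inj₁ refl
∨-true⁻ {false} h = inj₂ h

not-true⁻ : ∀ {b : Bool} → not b ≡ true → b ≡ false
not-true⁻ {false} _ = refl

not-true⁺ : ∀ {b : Bool} → b ≡ false → not b ≡ true
not-true⁺ refl = refl

true≢false : true ≢ false
true≢false ()

true-or-false : (b : Bool) → b ≡ true ⊎ b ≡ false
true-or-false true  = inj₁ refl
true-or-false false = inj₂ refl

module _ {a} {X : Set a} where

  filterᵇ-accept : (b : X → Bool) {x : X} {xs : List X} → b x ≡ true → filterᵇ b (x ∷ xs) ≡ x ∷ filterᵇ b xs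
  filterᵇ-accept b = LP.filter-accept (λ x → b x ≟ᵇ true)

  filterᵇ-reject : (b : X → Bool) {x : X} {xs : List X} → b x ≡ false → filterᵇ b (x ∷ xs) ≡ filterᵇ b xs
  filterᵇ-reject b bx = LP.filter-reject (λ x → b x ≟ᵇ true) λ bx≡true → true≢false (trans (sym bx≡true) bx)

  filterᵇ-all : (b : X → Bool) (xs : List X) → (∀ x → x ∈ xs → b x ≡ true) → filterᵇ b xs ≡ xs
  filterᵇ-all b xs h = LP.filter-all (λ x → b x ≟ᵇ true) (All.tabulate (h _))

  filterᵇ-cong : (b c : X → Bool) (xs : List X) → (∀ x → x ∈ xs → b x ≡ c x) → filterᵇ b xs ≡ filterᵇ c xs
  filterᵇ-cong b c []       h = refl
  filterᵇ-cong b c (x ∷ xs) h with b x in bx | c x in cx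
  ... | true  | true  = cong (x ∷_) (filterᵇ-cong b c xs (λ y y∈ → h y (there y∈)))
  ... | false | false = filterᵇ-cong b c xs (λ y y∈ → h y (there y∈))
  ... | true  | false = ⊥-elim (true≢false (trans (sym bx) (trans (h x (here refl)) cx)))
  ... | false | true  = ⊥-elim (true≢false (trans (sym cx) (trans (sym (h x (here refl))) bx)))

  filterᵇ-filterᵇ : (b c : X → Bool) (xs : List X) → filterᵇ b (filterᵇ c xs) ≡ filterᵇ (λ x → c x ∧ b x) xs
  filterᵇ-filterᵇ b c [] = refl
  filterᵇ-filterᵇ b c (x ∷ xs) with c x
  ... | false = filterᵇ-filterᵇ b c xs
  ... | true with b x
  ...   | true  = cong (x ∷_) (filterᵇ-filterᵇ b c xs)
  ...   | false = filterᵇ-filterᵇ b c xs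

  ∈-filterᵇ⁻ : (b : X → Bool) {x : X} (xs : List X) → x ∈ filterᵇ b xs → x ∈ xs × b x ≡ true
  ∈-filterᵇ⁻ b xs = MP.∈-filter⁻ (λ x → b x ≟ᵇ true)

  ∈-filterᵇ⁺ : (b : X → Bool) {x : X} (xs : List X) → x ∈ xs → b x ≡ true → x ∈ filterᵇ b xs
  ∈-filterᵇ⁺ b xs = MP.∈-filter⁺ (λ x → b x ≟ᵇ true)

  length-filterᵇ : (b : X → Bool) (xs : List X) → length (filterᵇ b xs) ≤ length xs
  length-filterᵇ b = LP.length-filter (λ x → b x ≟ᵇ true)

  length-filterᵇ-< : (b : X → Bool) {x : X} (xs : List X) → x ∈ xs → b x ≡ false →
                     length (filterᵇ b xs) < length xs
  length-filterᵇ-< b xs x∈ bx = LP.filter-notAll (λ x → b x ≟ᵇ true) xs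
    (Any.map (λ { refl bx≡true → true≢false (trans (sym bx≡true) bx) }) x∈)

  map-cong-∈ : ∀ {b} {Y : Set b} (f g : X → Y) (xs : List X) → (∀ x → x ∈ xs → f x ≡ g x) → map f xs ≡ map g xs
  map-cong-∈ f g xs h = LP.map-cong-local (All.tabulate (h _))

  allᵇ⁻ : (p : X → Bool) (xs : List X) → allᵇ p xs ≡ true → ∀ x → x ∈ xs → p x ≡ true
  allᵇ⁻ p (y ∷ xs) h x (here refl) = proj₁ (∧-true⁻ h)
  allᵇ⁻ p (y ∷ xs) h x (there x∈)  = allᵇ⁻ p xs (proj₂ (∧-true⁻ {p y} h)) x x∈

  allᵇ⁺ : (p : X → Bool) (xs : List X) → (∀ x → x ∈ xs → p x ≡ true) → allᵇ p xs ≡ true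
  allᵇ⁺ p []       h = refl
  allᵇ⁺ p (y ∷ xs) h = ∧-true⁺ (h y (here refl)) (allᵇ⁺ p xs (λ x x∈ → h x (there x∈)))

  allᵇ-++ : (p : X → Bool) (xs ys : List X) → allᵇ p (xs ++ ys) ≡ allᵇ p xs ∧ allᵇ p ys
  allᵇ-++ p []       ys = refl
  allᵇ-++ p (x ∷ xs) ys = trans (cong (p x ∧_) (allᵇ-++ p xs ys)) (sym (∧-assoc (p x) _ _))

  anyᵇ⁻ : (p : X → Bool) (xs : List X) → anyᵇ p xs ≡ true → Σ X λ x → x ∈ xs × p x ≡ true
  anyᵇ⁻ p (y ∷ xs) h with p y in py
  ... | true  = y , here refl , py
  ... | false = let (x , x∈ , px) = anyᵇ⁻ p xs h in x , there x∈ , px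

  anyᵇ⁺ : (p : X → Bool) (xs : List X) (x : X) → x ∈ xs → p x ≡ true → anyᵇ p xs ≡ true
  anyᵇ⁺ p (y ∷ xs) x (here refl) px rewrite px = refl
  anyᵇ⁺ p (y ∷ xs) x (there x∈)  px with p y
  ... | true  = refl
  ... | false = anyᵇ⁺ p xs x x∈ px

  anyᵇ-false⁺ : (p : X → Bool) (xs : List X) → (∀ x → x ∈ xs → p x ≡ false) → anyᵇ p xs ≡ false
  anyᵇ-false⁺ p []       h = refl
  anyᵇ-false⁺ p (y ∷ xs) h rewrite h y (here refl) = anyᵇ-false⁺ p xs (λ x x∈ → h x (there x∈))

  count-map : ∀ {Y : Set a} (p : Y → Bool) (g : X → Y) (xs : List X) → count p (map g xs) ≡ count (λ x → p (g x)) xs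
  count-map p g []       = refl
  count-map p g (x ∷ xs) = cong ((if p (g x) then 1 else 0) +_) (count-map p g xs)

  count-cong : (p q : X → Bool) (xs : List X) → (∀ x → p x ≡ q x) → count p xs ≡ count q xs
  count-cong p q []       h = refl
  count-cong p q (x ∷ xs) h = cong₂ (λ b n → (if b then 1 else 0) + n) (h x) (count-cong p q xs h)

  count-false : (xs : List X) → count (λ _ → false) xs ≡ 0
  count-false []       = refl
  count-false (x ∷ xs) = count-false xs

  sum-filterᵇ : (p : X → Bool) (f : X → ℕ) (xs : List X) →
                sum (map f (filterᵇ p xs)) ≡ sum (map (λ x → if p x then f x else 0) xs)
  sum-filterᵇ p f []       = refl
  sum-filterᵇ p f (x ∷ xs) with p x
  ... | true  = cong (f x +_) (sum-filterᵇ p f xs)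
  ... | false = sum-filterᵇ p f xs

  sum-map-+ : (f g : X → ℕ) (xs : List X) → sum (map (λ x → f x + g x) xs) ≡ sum (map f xs) + sum (map g xs)
  sum-map-+ f g []       = refl
  sum-map-+ f g (x ∷ xs) = trans (cong (f x + g x +_) (sum-map-+ f g xs))
                                 (+-interchange (f x) (g x) (sum (map f xs)) (sum (map g xs)))

++-injective : ∀ {a} {A : Set a} (xs ys r r′ : List A) → xs ++ r ≡ ys ++ r′ → length xs ≡ length ys → xs ≡ ys × r ≡ r′
++-injective []       []       r r′ eq _ = refl , eq
++-injective (x ∷ xs) (y ∷ ys) r r′ eq |xs|≡|ys| with LP.∷-injective eq
... | refl , eq′ with ++-injective xs ys r r′ eq′ (NP.suc-injective |xs|≡|ys|)
...   | refl , r≡r′ = refl , r≡r′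

↭-from-set : ∀ {a} {X : Set a} {xs ys : List X} → Unique xs → Unique ys →
             (∀ x → x ∈ xs → x ∈ ys) → (∀ x → x ∈ ys → x ∈ xs) → xs ↭ ys
↭-from-set uxs uys xs⊆ys ys⊆xs = ∼bag⇒↭ (unique∧set⇒bag uxs uys (mk⇔ (xs⊆ys _) (ys⊆xs _)))

module Membershipᵇ {X : Set} (_≟_ : DecidableEquality X) where

  -- definitionally the _∈ᵇ_ of Matchings, so these lemmas apply to its membership tests
  _∈ᵇ_ : X → List X → Bool
  u ∈ᵇ xs = anyᵇ (λ x → does (u ≟ x)) xs

  ∈ᵇ⁺ : (u : X) (xs : List X) → u ∈ xs → u ∈ᵇ xs ≡ true
  ∈ᵇ⁺ u xs u∈ = anyᵇ⁺ (λ x → does (u ≟ x)) xs u u∈ (dec-true (u ≟ u) refl)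

  ∈ᵇ⁻ : (u : X) (xs : List X) → u ∈ᵇ xs ≡ true → u ∈ xs
  ∈ᵇ⁻ u xs h with anyᵇ⁻ (λ x → does (u ≟ x)) xs h
  ... | x , x∈ , d with u ≟ x
  ...   | yes refl = x∈

  ∉ᵇ⁺ : (u : X) (xs : List X) → ¬ (u ∈ xs) → u ∈ᵇ xs ≡ false
  ∉ᵇ⁺ u xs u∉ with u ∈ᵇ xs in h
  ... | true  = ⊥-elim (u∉ (∈ᵇ⁻ u xs h))
  ... | false = refl

  ∉ᵇ⁻ : (u : X) (xs : List X) → u ∈ᵇ xs ≡ false → ¬ (u ∈ xs)
  ∉ᵇ⁻ u xs h u∈ = true≢false (trans (sym (∈ᵇ⁺ u xs u∈)) h)

opaque
  fromℕ : ℕ → ℚ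
  fromℕ a = ℤ.+ a / 1

  fromℕ-0 : fromℕ 0 ≡ 0ℚ
  fromℕ-0 = refl

  fromℕ-1 : fromℕ 1 ≡ 1ℚ
  fromℕ-1 = refl

  fromℕ-+ : ∀ a b → fromℕ (a + b) ≡ fromℕ a ℚ.+ fromℕ b
  fromℕ-+ a b = ℚP.toℚᵘ-injective (ℚᵘP.≃-trans (ℚP.toℚᵘ-fromℚᵘ (mkℚᵘ (ℤ.+ (a + b)) 0))
    (ℚᵘP.≃-sym (ℚᵘP.≃-trans (ℚP.toℚᵘ-homo-+ (fromℕ a) (fromℕ b))
      (ℚᵘP.≃-trans (ℚᵘP.+-cong (ℚP.toℚᵘ-fromℚᵘ (mkℚᵘ (ℤ.+ a) 0)) (ℚP.toℚᵘ-fromℚᵘ (mkℚᵘ (ℤ.+ b) 0)))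
        (*≡* eq)))))
    where
    eq : ((ℤ.+ a ℤ.* ℤ.+ 1) ℤ.+ (ℤ.+ b ℤ.* ℤ.+ 1)) ℤ.* ℤ.+ 1 ≡ ℤ.+ (a + b) ℤ.* ℤ.+ 1
    eq = cong (ℤ._* ℤ.+ 1) (trans (cong₂ ℤ._+_ (ℤP.*-identityʳ (ℤ.+ a)) (ℤP.*-identityʳ (ℤ.+ b))) (sym (ℤP.pos-+ a b)))

  fromℕ-* : ∀ a b → fromℕ (a * b) ≡ fromℕ a ℚ.* fromℕ b
  fromℕ-* a b = ℚP.toℚᵘ-injective (ℚᵘP.≃-trans (ℚP.toℚᵘ-fromℚᵘ (mkℚᵘ (ℤ.+ (a * b)) 0))
    (ℚᵘP.≃-sym (ℚᵘP.≃-trans (ℚP.toℚᵘ-homo-* (fromℕ a) (fromℕ b))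
      (ℚᵘP.≃-trans (ℚᵘP.*-cong (ℚP.toℚᵘ-fromℚᵘ (mkℚᵘ (ℤ.+ a) 0)) (ℚP.toℚᵘ-fromℚᵘ (mkℚᵘ (ℤ.+ b) 0)))
        (*≡* (cong (ℤ._* ℤ.+ 1) (sym (ℤP.pos-* a b))))))))

  /-*-fromℕ : ∀ a b → (ℤ.+ a / suc b) ℚ.* fromℕ (suc b) ≡ fromℕ a
  /-*-fromℕ a b = ℚP.toℚᵘ-injective (ℚᵘP.≃-trans (ℚP.toℚᵘ-homo-* (ℤ.+ a / suc b) (fromℕ (suc b)))
    (ℚᵘP.≃-trans (ℚᵘP.*-cong (ℚP.toℚᵘ-fromℚᵘ (mkℚᵘ (ℤ.+ a) b)) (ℚP.toℚᵘ-fromℚᵘ (mkℚᵘ (ℤ.+ suc b) 0)))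
      (ℚᵘP.≃-trans (*≡* eq) (ℚᵘP.≃-sym (ℚP.toℚᵘ-fromℚᵘ (mkℚᵘ (ℤ.+ a) 0))))))
    where
    eq : (ℤ.+ a ℤ.* ℤ.+ suc b) ℤ.* ℤ.+ 1 ≡ ℤ.+ a ℤ.* ℤ.+ suc (b * 1)
    eq rewrite NP.*-identityʳ b = ℤP.*-identityʳ _

inv-unique : ∀ p r → p ℚ.* r ≡ 1ℚ → inv p ≡ r
inv-unique p r pr with p ℚP.≟ 0ℚ
... | yes refl = ⊥-elim (0≢1 (trans (sym (ℚP.*-zeroˡ r)) pr))
  where 0≢1 : 0ℚ ≢ 1ℚ
        0≢1 ()
... | no p≢0 = begin
  1/p                  ≡⟨ sym (ℚP.*-identityʳ 1/p) ⟩
  1/p ℚ.* 1ℚ           ≡⟨ cong (1/p ℚ.*_) (sym pr) ⟩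
  1/p ℚ.* (p ℚ.* r)    ≡⟨ sym (ℚP.*-assoc 1/p p r) ⟩
  (1/p ℚ.* p) ℚ.* r    ≡⟨ cong (ℚ._* r) (ℚP.*-inverseˡ p {{ℚ.≢-nonZero p≢0}}) ⟩
  1ℚ ℚ.* r             ≡⟨ ℚP.*-identityˡ r ⟩
  r                    ∎
  where
  open ≡-Reasoning
  1/p = (1/ p) {{ℚ.≢-nonZero p≢0}}

ratio : ℕ → ℕ → ℚ
ratio a b = fromℕ a ℚ.* inv (fromℕ b)

ratio-self : ∀ n .{{_ : ℕ.NonZero n}} → ratio n n ≡ 1ℚ
ratio-self (suc n) = trans (cong (fromℕ (suc n) ℚ.*_) (inv-unique (fromℕ (suc n)) _ n*1/n≡1)) n*1/n≡1
  where
  n*1/n≡1 : fromℕ (suc n) ℚ.* (ℤ.+ 1 / suc n) ≡ 1ℚ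
  n*1/n≡1 = trans (ℚP.*-comm (fromℕ (suc n)) (ℤ.+ 1 / suc n)) (trans (/-*-fromℕ 1 n) fromℕ-1)

/≡ratio : ∀ a n .{{_ : ℕ.NonZero n}} → ℤ.+ a / n ≡ ratio a n
/≡ratio a (suc n) = begin
  ℤ.+ a / suc n                                                   ≡⟨ sym (ℚP.*-identityʳ (ℤ.+ a / suc n)) ⟩
  (ℤ.+ a / suc n) ℚ.* 1ℚ                                          ≡⟨ cong ((ℤ.+ a / suc n) ℚ.*_) (sym (ratio-self (suc n))) ⟩
  (ℤ.+ a / suc n) ℚ.* (fromℕ (suc n) ℚ.* inv (fromℕ (suc n)))     ≡⟨ sym (ℚP.*-assoc (ℤ.+ a / suc n) _ _) ⟩
  ((ℤ.+ a / suc n) ℚ.* fromℕ (suc n)) ℚ.* inv (fromℕ (suc n))     ≡⟨ cong (ℚ._* inv (fromℕ (suc n))) (/-*-fromℕ a n) ⟩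
  ratio a (suc n)                                               ∎
  where open ≡-Reasoning

ratio-trans : ∀ a b c .{{_ : ℕ.NonZero b}} → ratio a b ℚ.* ratio b c ≡ ratio a c
ratio-trans a b c = trans
  (solve 4 (λ a ib b ic → (a :* ib) :* (b :* ic) := (a :* ic) :* (b :* ib)) refl (fromℕ a) (inv (fromℕ b)) (fromℕ b) (inv (fromℕ c)))
  (trans (cong (ratio a c ℚ.*_) (ratio-self b)) (ℚP.*-identityʳ (ratio a c)))

sumℚ-ratio : ∀ {X : Set} (c : X → ℕ) (a : ℕ) (xs : List X) →
             sumℚ (map (λ x → ratio (c x) a) xs) ≡ ratio (sum (map c xs)) a
sumℚ-ratio c a []       = sym (trans (cong (ℚ._* inv (fromℕ a)) fromℕ-0) (ℚP.*-zeroˡ (inv (fromℕ a))))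
sumℚ-ratio c a (x ∷ xs) = trans (cong (ratio (c x) a ℚ.+_) (sumℚ-ratio c a xs))
  (trans (sym (ℚP.*-distribʳ-+ (inv (fromℕ a)) (fromℕ (c x)) _)) (cong (ℚ._* inv (fromℕ a)) (sym (fromℕ-+ (c x) _))))

ratio≡inv-1+sum : ∀ {X : Set} (c : X → ℕ) (a b : ℕ) (xs : List X) .{{_ : ℕ.NonZero a}} .{{_ : ℕ.NonZero b}} →
                  b ≡ a + sum (map c xs) → ratio a b ≡ inv (1ℚ ℚ.+ sumℚ (map (λ x → ratio (c x) a) xs))
ratio≡inv-1+sum c a b xs b≡ rewrite sumℚ-ratio c a xs = sym (inv-unique (1ℚ ℚ.+ s ℚ.* ia) (ratio a b) (begin
  (1ℚ ℚ.+ s ℚ.* ia) ℚ.* (fromℕ a ℚ.* ib)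
    ≡⟨ cong (λ o → (o ℚ.+ s ℚ.* ia) ℚ.* (fromℕ a ℚ.* ib)) (sym (ratio-self a)) ⟩
  (fromℕ a ℚ.* ia ℚ.+ s ℚ.* ia) ℚ.* (fromℕ a ℚ.* ib)
    ≡⟨ solve 4 (λ a ia s ib → (a :* ia :+ s :* ia) :* (a :* ib) := ((a :+ s) :* ib) :* (a :* ia)) refl (fromℕ a) ia s ib ⟩
  ((fromℕ a ℚ.+ s) ℚ.* ib) ℚ.* (fromℕ a ℚ.* ia)
    ≡⟨ cong (λ o → (o ℚ.* ib) ℚ.* (fromℕ a ℚ.* ia)) (trans (sym (fromℕ-+ a _)) (cong fromℕ (sym b≡))) ⟩
  ratio b b ℚ.* ratio a a                           ≡⟨ cong₂ ℚ._*_ (ratio-self b) (ratio-self a) ⟩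
  1ℚ                                                ∎))
  where
  open ≡-Reasoning
  s  = fromℕ (sum (map c xs))
  ia = inv (fromℕ a)
  ib = inv (fromℕ b)

*-inv : ∀ p → p ≢ 0ℚ → p ℚ.* inv p ≡ 1ℚ
*-inv p p≢0 with p ℚP.≟ 0ℚ
... | yes p≡0 = ⊥-elim (p≢0 p≡0)
... | no p≢0′ = ℚP.*-inverseʳ p {{ℚ.≢-nonZero p≢0′}}

-- inv 0ℚ = 0ℚ makes inv multiplicative without side conditions
inv-* : ∀ p r → inv (p ℚ.* r) ≡ inv p ℚ.* inv r
inv-* p r = case ((p ℚP.≟ 0ℚ) , (r ℚP.≟ 0ℚ)) of λ
  { (yes refl , _) → trans (cong inv (ℚP.*-zeroˡ r)) (sym (ℚP.*-zeroˡ (inv r)))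
  ; (no _ , yes refl) → trans (cong inv (ℚP.*-zeroʳ p)) (sym (ℚP.*-zeroʳ (inv p)))
  ; (no p≢0 , no r≢0) → inv-unique (p ℚ.* r) (inv p ℚ.* inv r) (begin
      (p ℚ.* r) ℚ.* (inv p ℚ.* inv r)
        ≡⟨ solve 4 (λ p r ip ir → (p :* r) :* (ip :* ir) := (p :* ip) :* (r :* ir)) refl p r (inv p) (inv r) ⟩
      (p ℚ.* inv p) ℚ.* (r ℚ.* inv r)  ≡⟨ cong₂ ℚ._*_ (*-inv p p≢0) (*-inv r r≢0) ⟩
      1ℚ                               ∎) }
  where open ≡-Reasoning

ratio-*-ratio : ∀ a b c d → ratio a b ℚ.* ratio c d ≡ ratio (a * c) (b * d)
ratio-*-ratio a b c d = begin
  (fromℕ a ℚ.* inv (fromℕ b)) ℚ.* (fromℕ c ℚ.* inv (fromℕ d))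
    ≡⟨ solve 4 (λ a ib c id → (a :* ib) :* (c :* id) := (a :* c) :* (ib :* id)) refl
               (fromℕ a) (inv (fromℕ b)) (fromℕ c) (inv (fromℕ d)) ⟩
  (fromℕ a ℚ.* fromℕ c) ℚ.* (inv (fromℕ b) ℚ.* inv (fromℕ d))
    ≡⟨ cong₂ ℚ._*_ (sym (fromℕ-* a c)) (trans (sym (inv-* (fromℕ b) (fromℕ d))) (cong inv (sym (fromℕ-* b d)))) ⟩
  ratio (a * c) (b * d) ∎
  where open ≡-Reasoning

prodℚ-ratio : ∀ {X : Set} (a b : X → ℕ) (xs : List X) →
              prodℚ (map (λ x → ratio (a x) (b x)) xs) ≡ ratio (product (map a xs)) (product (map b xs))
prodℚ-ratio a b []       = sym (ratio-self 1)
prodℚ-ratio a b (x ∷ xs) = trans (cong (ratio (a x) (b x) ℚ.*_) (prodℚ-ratio a b xs)) (ratio-*-ratio (a x) (b x) _ _)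

ratio-cancelʳ : ∀ a b c .{{_ : ℕ.NonZero c}} → ratio (a * c) (b * c) ≡ ratio a b
ratio-cancelʳ a b c = trans (sym (ratio-*-ratio a b c c)) (trans (cong (ratio a b ℚ.*_) (ratio-self c)) (ℚP.*-identityʳ (ratio a b)))

sumℚ-↭ : ∀ {xs ys} → xs ↭ ys → sumℚ xs ≡ sumℚ ys
sumℚ-↭ p = foldr-commMonoid +-0.setoid +-0.isCommutativeMonoid (↭⇒↭ₛ p)
  where module +-0 = CommutativeMonoid ℚP.+-0-commutativeMonoid

prodℚ-↭ : ∀ {xs ys} → xs ↭ ys → prodℚ xs ≡ prodℚ ys
prodℚ-↭ p = foldr-commMonoid *-1.setoid *-1.isCommutativeMonoid (↭⇒↭ₛ p)
  where module *-1 = CommutativeMonoid ℚP.*-1-commutativeMonoid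

module MatchingCounts {V E : Set} (_≟_ : DecidableEquality V) (verts : E → List V) where
  open Matchings _≟_ verts public
  open Membershipᵇ _≟_ using (∈ᵇ⁺; ∈ᵇ⁻)
  open ≡-Reasoning

  misses : List V → E → Bool
  misses A f = allᵇ (λ a → not (a ∈ᵇ verts f)) A

  _∖_ : List E → List V → List E
  es ∖ A = filterᵇ (misses A) es

  ∖-[] : (es : List E) → es ∖ [] ≡ es
  ∖-[] es = filterᵇ-all _ es (λ _ _ → refl)

  ∖-++ : (es : List E) (A B : List V) → (es ∖ A) ∖ B ≡ es ∖ (A ++ B)
  ∖-++ es A B = trans (filterᵇ-filterᵇ _ _ es) (filterᵇ-cong _ _ es (λ f _ → sym (allᵇ-++ _ A B)))

  ∖-comm : (es : List E) (A B : List V) → (es ∖ A) ∖ B ≡ (es ∖ B) ∖ A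
  ∖-comm es A B = trans (filterᵇ-filterᵇ _ _ es)
    (trans (filterᵇ-cong _ _ es (λ f _ → ∧-comm (misses A f) _)) (sym (filterᵇ-filterᵇ _ _ es)))

  ∖-cong : (es : List E) (A B : List V) → (∀ a → a ∈ A → a ∈ B) → (∀ a → a ∈ B → a ∈ A) → es ∖ A ≡ es ∖ B
  ∖-cong es A B A⊆B B⊆A = filterᵇ-cong _ _ es λ f _ → bool-ext
    (λ h → allᵇ⁺ _ B (λ a a∈ → allᵇ⁻ _ A h a (B⊆A a a∈)))
    (λ h → allᵇ⁺ _ A (λ a a∈ → allᵇ⁻ _ B h a (A⊆B a a∈)))

  length-∖ : (es : List E) (A : List V) → length (es ∖ A) ≤ length es
  length-∖ es A = length-filterᵇ _ es

  disjointᵇ⁻ : (e f : E) → disjointᵇ e f ≡ true → ∀ a → a ∈ verts e → ¬ (a ∈ verts f)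
  disjointᵇ⁻ e f h a a∈e a∈f =
    true≢false (trans (sym (∈ᵇ⁺ a (verts f) a∈f)) (not-true⁻ (allᵇ⁻ _ (verts e) h a a∈e)))

  disjointᵇ⁺ : (e f : E) → (∀ a → a ∈ verts e → ¬ (a ∈ verts f)) → disjointᵇ e f ≡ true
  disjointᵇ⁺ e f h = allᵇ⁺ _ (verts e) λ a a∈e → not-true⁺ (Membershipᵇ.∉ᵇ⁺ _≟_ a (verts f) (h a a∈e))

  disjointᵇ-sym : (e f : E) → disjointᵇ e f ≡ disjointᵇ f e
  disjointᵇ-sym e f = bool-ext (λ h → disjointᵇ⁺ f e (λ a a∈f a∈e → disjointᵇ⁻ e f h a a∈e a∈f))
                               (λ h → disjointᵇ⁺ e f (λ a a∈e a∈f → disjointᵇ⁻ f e h a a∈f a∈e))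

  disjointᵇ-false : (e f : E) (a : V) → a ∈ verts e → a ∈ verts f → disjointᵇ e f ≡ false
  disjointᵇ-false e f a a∈e a∈f with disjointᵇ e f in h
  ... | true  = ⊥-elim (disjointᵇ⁻ e f h a a∈e a∈f)
  ... | false = refl

  count-allᵇ-sublists : (p : E → Bool) (q : List E → Bool) (xs : List E) →
    count (λ M → allᵇ p M ∧ q M) (sublists xs) ≡ count q (sublists (filterᵇ p xs))
  count-allᵇ-sublists p q [] = refl
  count-allᵇ-sublists p q (x ∷ xs)
    rewrite count-++ (λ M → allᵇ p M ∧ q M) (sublists xs) (map (x ∷_) (sublists xs))
          | count-map (λ M → allᵇ p M ∧ q M) (x ∷_) (sublists xs)
          | count-allᵇ-sublists p q xs
    with p x
  ... | true
    rewrite count-++ q (sublists (filterᵇ p xs)) (map (x ∷_) (sublists (filterᵇ p xs)))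
          | count-map q (x ∷_) (sublists (filterᵇ p xs))
    = cong (count q (sublists (filterᵇ p xs)) +_) (count-allᵇ-sublists p (λ M → q (x ∷ M)) xs)
  ... | false rewrite count-false (sublists xs) = NP.+-identityʳ _

  -- a matching either omits x, or is x together with a matching of the edges disjoint from x
  #matchings-∷ : (x : E) (xs : List E) → #matchings (x ∷ xs) ≡ #matchings xs + #matchings (xs ∖ verts x)
  #matchings-∷ x xs
    rewrite count-++ isMatching (sublists xs) (map (x ∷_) (sublists xs))
          | count-map isMatching (x ∷_) (sublists xs)
    = cong (#matchings xs +_) (count-allᵇ-sublists (disjointᵇ x) isMatching xs)

  #avoiding≡#matchings-∖ : (es : List E) (u : V) → #avoiding es u ≡ #matchings (es ∖ (u ∷ []))
  #avoiding≡#matchings-∖ es u =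
    trans (count-cong _ _ (sublists es) (λ M → ∧-comm (isMatching M) (avoids u M)))
          (trans (count-allᵇ-sublists (λ e → not (u ∈ᵇ verts e)) isMatching es)
                 (cong (λ l → #matchings l) (filterᵇ-cong _ _ es (λ f _ → sym (∧-identityʳ _)))))

  #covering : V → List E → ℕ
  #covering x es = sum (map (λ e → #matchings (es ∖ verts e)) (filterᵇ (λ e → x ∈ᵇ verts e) es))

  SplitsAt : V → List E → Set
  SplitsAt x es = #matchings es ≡ #matchings (es ∖ (x ∷ [])) + #covering x es

  splitsAt-∷-through : (x : V) (y : E) (ys : List E) → x ∈ᵇ verts y ≡ true →
                       SplitsAt x ys → SplitsAt x (y ∷ ys)
  splitsAt-∷-through x y ys x∈ᵇy split = begin
    #matchings (y ∷ ys)                                       ≡⟨ #matchings-∷ y ys ⟩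
    #matchings ys + #matchings (ys ∖ verts y)                 ≡⟨ cong (_+ #matchings (ys ∖ verts y)) split ⟩
    #matchings (ys ∖ (x ∷ [])) + #covering x ys + #matchings (ys ∖ verts y)
      ≡⟨ NP.+-assoc (#matchings (ys ∖ (x ∷ []))) _ _ ⟩
    #matchings (ys ∖ (x ∷ [])) + (#covering x ys + #matchings (ys ∖ verts y))
      ≡⟨ cong (#matchings (ys ∖ (x ∷ [])) +_) (NP.+-comm (#covering x ys) _) ⟩
    #matchings (ys ∖ (x ∷ [])) + (#matchings (ys ∖ verts y) + #covering x ys)
      ≡⟨ sym (cong₂ (λ l r → #matchings l + r) y∉∖x covering-y∷ys) ⟩
    #matchings ((y ∷ ys) ∖ (x ∷ [])) + #covering x (y ∷ ys) ∎
    where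
    x∈y : x ∈ verts y
    x∈y = ∈ᵇ⁻ x (verts y) x∈ᵇy
    y∉∖x : (y ∷ ys) ∖ (x ∷ []) ≡ ys ∖ (x ∷ [])
    y∉∖x = filterᵇ-reject (misses (x ∷ [])) {xs = ys} (cong (λ b → not b ∧ true) x∈ᵇy)
    y∉∖at-x : ∀ e → x ∈ verts e → (y ∷ ys) ∖ verts e ≡ ys ∖ verts e
    y∉∖at-x e x∈e = filterᵇ-reject (misses (verts e)) {xs = ys} (disjointᵇ-false e y x x∈e x∈y)
    covering-y∷ys : #covering x (y ∷ ys) ≡ #matchings (ys ∖ verts y) + #covering x ys
    covering-y∷ys rewrite filterᵇ-accept (λ e → x ∈ᵇ verts e) {xs = ys} x∈ᵇy =
      cong₂ (λ l r → #matchings l + sum r) (y∉∖at-x y x∈y)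
        (map-cong-∈ _ _ _ λ e e∈ → cong #matchings (y∉∖at-x e (∈ᵇ⁻ x (verts e) (proj₂ (∈-filterᵇ⁻ _ ys e∈)))))

  splitsAt-∷-avoiding : (x : V) (y : E) (ys : List E) → x ∈ᵇ verts y ≡ false →
                        SplitsAt x ys → SplitsAt x (ys ∖ verts y) → SplitsAt x (y ∷ ys)
  splitsAt-∷-avoiding x y ys x∉ᵇy split split∖y = begin
    #matchings (y ∷ ys)                          ≡⟨ #matchings-∷ y ys ⟩
    #matchings ys + #matchings (ys ∖ verts y)    ≡⟨ cong₂ _+_ split split∖y ⟩
    (a + S₁) + (#matchings ((ys ∖ verts y) ∖ (x ∷ [])) + #covering x (ys ∖ verts y))
      ≡⟨ cong₂ (λ l s → (a + S₁) + (#matchings l + s)) (∖-comm ys (verts y) (x ∷ [])) covering-∖y ⟩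
    (a + S₁) + (c + S₂)                          ≡⟨ +-interchange a S₁ c S₂ ⟩
    (a + c) + (S₁ + S₂)
      ≡⟨ sym (cong₂ _+_ (trans (cong #matchings y∈∖x) (#matchings-∷ y (ys ∖ (x ∷ [])))) covering-y∷ys) ⟩
    #matchings ((y ∷ ys) ∖ (x ∷ [])) + #covering x (y ∷ ys) ∎
    where
    at-x : E → Bool
    at-x e = x ∈ᵇ verts e
    -- the matchings covering x through e that also use y
    h : E → ℕ
    h e = if disjointᵇ e y then #matchings ((ys ∖ verts e) ∖ verts y) else 0
    a = #matchings (ys ∖ (x ∷ []))
    c = #matchings ((ys ∖ (x ∷ [])) ∖ verts y)
    S₁ = #covering x ys
    S₂ = sum (map h (filterᵇ at-x ys))
    y∈∖x : (y ∷ ys) ∖ (x ∷ []) ≡ y ∷ (ys ∖ (x ∷ []))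
    y∈∖x = filterᵇ-accept (misses (x ∷ [])) {xs = ys} (cong (λ b → not b ∧ true) x∉ᵇy)
    #matchings-y∷ys∖ : ∀ e → #matchings ((y ∷ ys) ∖ verts e) ≡ #matchings (ys ∖ verts e) + h e
    #matchings-y∷ys∖ e with disjointᵇ e y
    ... | true  = #matchings-∷ y (ys ∖ verts e)
    ... | false = sym (NP.+-identityʳ _)
    covering-y∷ys : #covering x (y ∷ ys) ≡ S₁ + S₂
    covering-y∷ys rewrite filterᵇ-reject at-x {xs = ys} x∉ᵇy = trans (cong sum (LP.map-cong #matchings-y∷ys∖ (filterᵇ at-x ys)))
                          (sum-map-+ (λ e → #matchings (ys ∖ verts e)) h (filterᵇ at-x ys))
    covering-∖y : #covering x (ys ∖ verts y) ≡ S₂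
    covering-∖y =
      trans (cong (λ l → sum (map (λ e → #matchings ((ys ∖ verts y) ∖ verts e)) l)) (filterᵇ-filterᵇ at-x (disjointᵇ y) ys))
      (trans (sum-filterᵇ _ _ ys) (trans (cong sum (map-cong-∈ _ _ ys pointwise)) (sym (sum-filterᵇ at-x h ys))))
      where
      pointwise : ∀ e → e ∈ ys → (if disjointᵇ y e ∧ at-x e then #matchings ((ys ∖ verts y) ∖ verts e) else 0)
                                 ≡ (if at-x e then h e else 0)
      pointwise e _ rewrite disjointᵇ-sym y e with at-x e | disjointᵇ e y
      ... | true  | true  = cong #matchings (∖-comm ys (verts y) (verts e))
      ... | true  | false = refl
      ... | false | true  = refl
      ... | false | false = refl

  splitsAt-∖ : (x : V) (es : List E) (A : List V) → SplitsAt x (es ∖ A)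
  splitsAt-∖ x []       A = refl
  splitsAt-∖ x (y ∷ ys) A with misses A y
  ... | false = splitsAt-∖ x ys A
  ... | true with true-or-false (x ∈ᵇ verts y)
  ...   | inj₁ x∈ᵇy = splitsAt-∷-through x y (ys ∖ A) x∈ᵇy (splitsAt-∖ x ys A)
  ...   | inj₂ x∉ᵇy = splitsAt-∷-avoiding x y (ys ∖ A) x∉ᵇy (splitsAt-∖ x ys A)
                        (subst (SplitsAt x) (sym (∖-++ ys A (verts y))) (splitsAt-∖ x ys (A ++ verts y)))

  #matchings-split : (x : V) (es : List E) → SplitsAt x es
  #matchings-split x es = subst (SplitsAt x) (∖-[] es) (splitsAt-∖ x es [])

  Exclusive : (E → Bool) → (E → Bool) → List E → Set
  Exclusive p q xs = ∀ y → y ∈ xs → p y ≡ true → q y ≡ false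

  Separated : (E → Bool) → (E → Bool) → List E → Set
  Separated p q xs = ∀ y z → y ∈ xs → z ∈ xs → p y ≡ true → q z ≡ true → disjointᵇ y z ≡ true

  -- matchings of two mutually disjoint edge classes are independent pairs of matchings
  #matchings-∨ : (p q : E → Bool) (xs : List E) → Exclusive p q xs → Separated p q xs →
    #matchings (filterᵇ (λ e → p e ∨ q e) xs) ≡ #matchings (filterᵇ p xs) * #matchings (filterᵇ q xs)

  #matchings-∨-headˡ : (p q : E → Bool) (x : E) (xs : List E) → p x ≡ true → q x ≡ false →
    Exclusive p q (x ∷ xs) → Separated p q (x ∷ xs) →
    #matchings (filterᵇ (λ e → p e ∨ q e) (x ∷ xs)) ≡ #matchings (filterᵇ p (x ∷ xs)) * #matchings (filterᵇ q (x ∷ xs))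

  #matchings-∨-headʳ : (p q : E → Bool) (x : E) (xs : List E) → p x ≡ false → q x ≡ true →
    Exclusive p q (x ∷ xs) → Separated p q (x ∷ xs) →
    #matchings (filterᵇ (λ e → p e ∨ q e) (x ∷ xs)) ≡ #matchings (filterᵇ p (x ∷ xs)) * #matchings (filterᵇ q (x ∷ xs))

  #matchings-∨ p q [] _ _ = refl
  #matchings-∨ p q (x ∷ xs) excl sep with true-or-false (p x) | true-or-false (q x)
  ... | inj₁ px | inj₁ qx = ⊥-elim (true≢false (trans (sym qx) (excl x (here refl) px)))
  ... | inj₁ px | inj₂ qx = #matchings-∨-headˡ p q x xs px qx excl sep
  ... | inj₂ px | inj₁ qx = #matchings-∨-headʳ p q x xs px qx excl sep
  ... | inj₂ px | inj₂ qx = begin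
    #matchings (filterᵇ (λ e → p e ∨ q e) (x ∷ xs))
      ≡⟨ cong #matchings (filterᵇ-reject (λ e → p e ∨ q e) {xs = xs} (cong₂ _∨_ px qx)) ⟩
    #matchings (filterᵇ (λ e → p e ∨ q e) xs)
      ≡⟨ #matchings-∨ p q xs (λ y y∈ → excl y (there y∈)) (λ y z y∈ z∈ → sep y z (there y∈) (there z∈)) ⟩
    #matchings (filterᵇ p xs) * #matchings (filterᵇ q xs)
      ≡⟨ sym (cong₂ _*_ (cong #matchings (filterᵇ-reject p {xs = xs} px)) (cong #matchings (filterᵇ-reject q {xs = xs} qx))) ⟩
    #matchings (filterᵇ p (x ∷ xs)) * #matchings (filterᵇ q (x ∷ xs)) ∎

  #matchings-∨-headˡ p q x xs px qx excl sep = begin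
    #matchings (filterᵇ p∨q (x ∷ xs))
      ≡⟨ cong #matchings (filterᵇ-accept p∨q {xs = xs} (cong (_∨ q x) px)) ⟩
    #matchings (x ∷ filterᵇ p∨q xs)
      ≡⟨ #matchings-∷ x (filterᵇ p∨q xs) ⟩
    #matchings (filterᵇ p∨q xs) + #matchings (filterᵇ (disjointᵇ x) (filterᵇ p∨q xs))
      ≡⟨ cong (λ l → #matchings (filterᵇ p∨q xs) + #matchings l)
              (trans (filterᵇ-filterᵇ _ p∨q xs) (filterᵇ-cong _ _ xs x-misses-q)) ⟩
    #matchings (filterᵇ p∨q xs) + #matchings (filterᵇ (λ e → p∧x e ∨ q e) xs)
      ≡⟨ cong₂ _+_ (#matchings-∨ p q xs excl′ sep′)
                   (#matchings-∨ p∧x q xs (λ y y∈ h → excl′ y y∈ (proj₁ (∧-true⁻ h)))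
                                         (λ y z y∈ z∈ h → sep′ y z y∈ z∈ (proj₁ (∧-true⁻ h)))) ⟩
    #matchings (filterᵇ p xs) * #matchings (filterᵇ q xs) + #matchings (filterᵇ p∧x xs) * #matchings (filterᵇ q xs)
      ≡⟨ sym (NP.*-distribʳ-+ (#matchings (filterᵇ q xs)) (#matchings (filterᵇ p xs)) _) ⟩
    (#matchings (filterᵇ p xs) + #matchings (filterᵇ p∧x xs)) * #matchings (filterᵇ q xs)
      ≡⟨ sym (cong₂ _*_ (trans (cong #matchings (filterᵇ-accept p {xs = xs} px))
                          (trans (#matchings-∷ x (filterᵇ p xs))
                                 (cong (λ l → #matchings (filterᵇ p xs) + #matchings l) (filterᵇ-filterᵇ _ p xs))))
                        (cong #matchings (filterᵇ-reject q {xs = xs} qx))) ⟩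
    #matchings (filterᵇ p (x ∷ xs)) * #matchings (filterᵇ q (x ∷ xs)) ∎
    where
    p∨q p∧x : E → Bool
    p∨q e = p e ∨ q e
    p∧x e = p e ∧ disjointᵇ x e
    excl′ : Exclusive p q xs
    excl′ y y∈ = excl y (there y∈)
    sep′ : Separated p q xs
    sep′ y z y∈ z∈ = sep y z (there y∈) (there z∈)
    x-misses-q : ∀ e → e ∈ xs → (p e ∨ q e) ∧ disjointᵇ x e ≡ p∧x e ∨ q e
    x-misses-q e e∈ with q e in qe
    ... | true rewrite sep x e (here refl) (there e∈) px qe = trans (∧-identityʳ _) (trans (∨-zeroʳ (p e)) (sym (∨-zeroʳ _)))
    ... | false = trans (cong (_∧ disjointᵇ x e) (∨-identityʳ (p e))) (sym (∨-identityʳ _))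

  #matchings-∨-headʳ p q x xs px qx excl sep = begin
    #matchings (filterᵇ p∨q (x ∷ xs))
      ≡⟨ cong #matchings (filterᵇ-accept p∨q {xs = xs} (trans (cong (_∨ q x) px) qx)) ⟩
    #matchings (x ∷ filterᵇ p∨q xs)
      ≡⟨ #matchings-∷ x (filterᵇ p∨q xs) ⟩
    #matchings (filterᵇ p∨q xs) + #matchings (filterᵇ (disjointᵇ x) (filterᵇ p∨q xs))
      ≡⟨ cong (λ l → #matchings (filterᵇ p∨q xs) + #matchings l)
              (trans (filterᵇ-filterᵇ _ p∨q xs) (filterᵇ-cong _ _ xs x-misses-p)) ⟩
    #matchings (filterᵇ p∨q xs) + #matchings (filterᵇ (λ e → p e ∨ q∧x e) xs)
      ≡⟨ cong₂ _+_ (#matchings-∨ p q xs excl′ sep′)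
                   (#matchings-∨ p q∧x xs (λ y y∈ py → cong (_∧ disjointᵇ x y) (excl′ y y∈ py))
                                         (λ y z y∈ z∈ py h → sep′ y z y∈ z∈ py (proj₁ (∧-true⁻ h)))) ⟩
    #matchings (filterᵇ p xs) * #matchings (filterᵇ q xs) + #matchings (filterᵇ p xs) * #matchings (filterᵇ q∧x xs)
      ≡⟨ sym (NP.*-distribˡ-+ (#matchings (filterᵇ p xs)) (#matchings (filterᵇ q xs)) _) ⟩
    #matchings (filterᵇ p xs) * (#matchings (filterᵇ q xs) + #matchings (filterᵇ q∧x xs))
      ≡⟨ sym (cong₂ _*_ (cong #matchings (filterᵇ-reject p {xs = xs} px))
                        (trans (cong #matchings (filterᵇ-accept q {xs = xs} qx))
                          (trans (#matchings-∷ x (filterᵇ q xs))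
                                 (cong (λ l → #matchings (filterᵇ q xs) + #matchings l) (filterᵇ-filterᵇ _ q xs))))) ⟩
    #matchings (filterᵇ p (x ∷ xs)) * #matchings (filterᵇ q (x ∷ xs)) ∎
    where
    p∨q q∧x : E → Bool
    p∨q e = p e ∨ q e
    q∧x e = q e ∧ disjointᵇ x e
    excl′ : Exclusive p q xs
    excl′ y y∈ = excl y (there y∈)
    sep′ : Separated p q xs
    sep′ y z y∈ z∈ = sep y z (there y∈) (there z∈)
    x-misses-p : ∀ e → e ∈ xs → (p e ∨ q e) ∧ disjointᵇ x e ≡ p e ∨ q∧x e
    x-misses-p e e∈ with p e in pe
    ... | true rewrite disjointᵇ-sym x e | sep e x (there e∈) (here refl) pe qx = refl
    ... | false = refl

  #matchings-⋁ : {Y : Set} (P : Y → E → Bool) (O : E → Bool) (Us : List Y) (xs : List E) → Unique Us →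
    (∀ U U′ e → U ∈ Us → U′ ∈ Us → e ∈ xs → P U e ≡ true → P U′ e ≡ true → U ≡ U′) →
    (∀ U → U ∈ Us → Exclusive (P U) O xs) →
    (∀ U U′ → U ∈ Us → U′ ∈ Us → U ≢ U′ → Separated (P U) (P U′) xs) →
    (∀ U → U ∈ Us → Separated (P U) O xs) →
    #matchings (filterᵇ (λ e → anyᵇ (λ U → P U e) Us ∨ O e) xs)
      ≡ product (map (λ U → #matchings (filterᵇ (P U) xs)) Us) * #matchings (filterᵇ O xs)
  #matchings-⋁ P O [] xs _ _ _ _ _ = sym (NP.+-identityʳ _)
  #matchings-⋁ P O (U ∷ Us) xs (U∉Us ∷ unique) same excl sepP sepO = begin
    #matchings (filterᵇ (λ e → (P U e ∨ rest e) ∨ O e) xs)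
      ≡⟨ cong #matchings (filterᵇ-cong _ _ xs (λ e _ → ∨-assoc (P U e) _ _)) ⟩
    #matchings (filterᵇ (λ e → P U e ∨ (rest e ∨ O e)) xs)
      ≡⟨ #matchings-∨ (P U) (λ e → rest e ∨ O e) xs excl-U sep-U ⟩
    #matchings (filterᵇ (P U) xs) * #matchings (filterᵇ (λ e → rest e ∨ O e) xs)
      ≡⟨ cong (#matchings (filterᵇ (P U) xs) *_)
              (#matchings-⋁ P O Us xs unique (λ U₁ U₂ e i₁ i₂ → same U₁ U₂ e (there i₁) (there i₂))
                 (λ U₁ i → excl U₁ (there i)) (λ U₁ U₂ i₁ i₂ → sepP U₁ U₂ (there i₁) (there i₂))
                 (λ U₁ i → sepO U₁ (there i))) ⟩
    #matchings (filterᵇ (P U) xs) * (product (map (λ U → #matchings (filterᵇ (P U) xs)) Us) * #matchings (filterᵇ O xs))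
      ≡⟨ sym (NP.*-assoc (#matchings (filterᵇ (P U) xs)) _ _) ⟩
    product (map (λ U → #matchings (filterᵇ (P U) xs)) (U ∷ Us)) * #matchings (filterᵇ O xs) ∎
    where
    rest : E → Bool
    rest e = anyᵇ (λ U′ → P U′ e) Us
    U≢ : ∀ U′ → U′ ∈ Us → U ≢ U′
    U≢ U′ i = All.lookup U∉Us i
    excl-U : Exclusive (P U) (λ e → rest e ∨ O e) xs
    excl-U y y∈ PUy = cong₂ _∨_
      (anyᵇ-false⁺ (λ U′ → P U′ y) Us λ U′ i → case true-or-false (P U′ y) of λ
        { (inj₁ PU′y) → ⊥-elim (U≢ U′ i (same U U′ y (here refl) (there i) y∈ PUy PU′y))
        ; (inj₂ ¬PU′y) → ¬PU′y })
      (excl U (here refl) y y∈ PUy)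
    sep-U : Separated (P U) (λ e → rest e ∨ O e) xs
    sep-U y z y∈ z∈ PUy h with true-or-false (rest z)
    ... | inj₁ rz = let (U′ , i , PU′z) = anyᵇ⁻ (λ U′ → P U′ z) Us rz in
                    sepP U U′ (here refl) (there i) (U≢ U′ i) y z y∈ z∈ PUy PU′z
    ... | inj₂ rz = sepO U (here refl) y z y∈ z∈ PUy (trans (sym (cong (_∨ O z) rz)) h)

  Prob≡ratio : (es : List E) (x : V) → Prob es x ≡ ratio (#matchings (es ∖ (x ∷ []))) (#matchings es)
  Prob≡ratio es x =
    trans (cong (λ a → (ℤ.+ a / #matchings es) {{#matchings-nonZero es}}) (#avoiding≡#matchings-∖ es x))
          (/≡ratio _ (#matchings es) {{#matchings-nonZero es}})

  Prob-recursion : (es : List E) (x : V) →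
    Prob es x ≡ inv (1ℚ ℚ.+ sumℚ (map (λ e → ratio (#matchings (es ∖ verts e)) (#matchings (es ∖ (x ∷ []))))
                                      (filterᵇ (λ e → x ∈ᵇ verts e) es)))
  Prob-recursion es x = trans (Prob≡ratio es x)
    (ratio≡inv-1+sum (λ e → #matchings (es ∖ verts e)) _ _ (filterᵇ (λ e → x ∈ᵇ verts e) es)
       {{#matchings-nonZero (es ∖ (x ∷ []))}} {{#matchings-nonZero es}} (#matchings-split x es))

  module Ordered (_≺_ : Rel V 0ℓ) (sto : IsStrictTotalOrder _≡_ _≺_) where
    open ≡-Reasoning
    open IsStrictTotalOrder sto using (compare; irrefl) renaming (trans to ≺-trans; _<?_ to _≺?_)

    below : V → List V → List V
    below u S = filter (_≺? u) S

    _─_ : List V → V → List V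
    S ─ m = filter (λ w → ¬? (w ≟ m)) S

    ∈─⁻ : ∀ S m {w} → w ∈ S ─ m → w ∈ S × w ≢ m
    ∈─⁻ S m = MP.∈-filter⁻ (λ w → ¬? (w ≟ m))

    ∈─⁺ : ∀ S m {w} → w ∈ S → w ≢ m → w ∈ S ─ m
    ∈─⁺ S m = MP.∈-filter⁺ (λ w → ¬? (w ≟ m))

    ─-unique : ∀ {S} m → Unique S → Unique (S ─ m)
    ─-unique m = Uniqueₚ.filter⁺ (λ w → ¬? (w ≟ m))

    length-─ : ∀ {S m} → m ∈ S → length (S ─ m) < length S
    length-─ {S} {m} m∈S = LP.filter-notAll (λ w → ¬? (w ≟ m)) S (Any.map (λ { refl m≢m → m≢m refl }) m∈S)

    ↭-∷─ : ∀ {S m} → Unique S → m ∈ S → S ↭ m ∷ (S ─ m)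
    ↭-∷─ {S} {m} uS m∈S = ↭-from-set uS (All.tabulate (λ w∈ m≡w → proj₂ (∈─⁻ S m w∈) (sym m≡w)) ∷ ─-unique m uS)
      (λ w w∈ → case w ≟ m of λ { (yes refl) → here refl ; (no w≢m) → there (∈─⁺ S m w∈ w≢m) })
      (λ { w (here refl) → m∈S ; w (there w∈) → proj₁ (∈─⁻ S m w∈) })

    IsMax : V → List V → Set
    IsMax m S = ∀ w → w ∈ S → w ≡ m ⊎ w ≺ m

    maximum : (x : V) (xs : List V) → Σ V λ m → m ∈ (x ∷ xs) × IsMax m (x ∷ xs)
    maximum x [] = x , here refl , λ { w (here refl) → inj₁ refl }
    maximum x (y ∷ ys) with maximum y ys
    ... | m , m∈ , max with compare x m
    ...   | tri< x≺m _ _  = m , there m∈ , λ { w (here refl) → inj₂ x≺m ; w (there w∈) → max w w∈ }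
    ...   | tri≈ _ refl _ = m , there m∈ , λ { w (here refl) → inj₁ refl ; w (there w∈) → max w w∈ }
    ...   | tri> _ _ m≺x  = x , here refl , λ { w (here refl) → inj₁ refl ; w (there w∈) → inj₂ (≺x w (max w w∈)) }
      where ≺x : ∀ w → w ≡ m ⊎ w ≺ m → w ≺ x
            ≺x w (inj₁ refl) = m≺x
            ≺x w (inj₂ w≺m)  = ≺-trans w≺m m≺x

    ≺max : ∀ {S m w} → IsMax m S → w ∈ S → w ≢ m → w ≺ m
    ≺max max w∈ w≢m with max _ w∈
    ... | inj₁ w≡m = ⊥-elim (w≢m w≡m)
    ... | inj₂ w≺m = w≺m

    ∖-below-max : (es : List E) {S : List V} {m : V} → IsMax m S → es ∖ below m S ≡ es ∖ (S ─ m)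
    ∖-below-max es {S} {m} max = ∖-cong es (below m S) (S ─ m)
      (λ w w∈ → let (w∈S , w≺m) = MP.∈-filter⁻ (_≺? m) w∈ in ∈─⁺ S m w∈S (λ { refl → irrefl refl w≺m }))
      (λ w w∈ → let (w∈S , w≢m) = ∈─⁻ S m w∈ in MP.∈-filter⁺ (_≺? m) w∈S (≺max max w∈S w≢m))

    ∖-below-─ : (es : List E) {S : List V} {m u : V} → IsMax m S → u ∈ S ─ m → es ∖ below u S ≡ es ∖ below u (S ─ m)
    ∖-below-─ es {S} {m} {u} max u∈ = ∖-cong es (below u S) (below u (S ─ m))
      (λ w w∈ → let (w∈S , w≺u) = MP.∈-filter⁻ (_≺? u) w∈ in
        MP.∈-filter⁺ (_≺? u) (∈─⁺ S m w∈S (λ { refl → irrefl refl (≺-trans w≺u u≺m) })) w≺u)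
      (λ w w∈ → let (w∈S─m , w≺u) = MP.∈-filter⁻ (_≺? u) w∈ in
        MP.∈-filter⁺ (_≺? u) (proj₁ (∈─⁻ S m w∈S─m)) w≺u)
      where u≺m = ≺max max (proj₁ (∈─⁻ S m u∈)) (proj₂ (∈─⁻ S m u∈))

    ∖-─-∷ : (es : List E) {S : List V} {m : V} → m ∈ S → (es ∖ (S ─ m)) ∖ (m ∷ []) ≡ es ∖ S
    ∖-─-∷ es {S} {m} m∈S = trans (∖-++ es (S ─ m) (m ∷ [])) (∖-cong es (S ─ m ++ m ∷ []) S ⊆ ⊇)
      where
      ⊆ : ∀ w → w ∈ S ─ m ++ m ∷ [] → w ∈ S
      ⊆ w w∈ with MP.∈-++⁻ (S ─ m) w∈
      ... | inj₁ w∈S─m = proj₁ (∈─⁻ S m w∈S─m)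
      ... | inj₂ (here refl) = m∈S
      ⊇ : ∀ w → w ∈ S → w ∈ S ─ m ++ m ∷ []
      ⊇ w w∈ with w ≟ m
      ... | yes refl = MP.∈-++⁺ʳ (S ─ m) (here refl)
      ... | no w≢m   = MP.∈-++⁺ˡ (∈─⁺ S m w∈ w≢m)

    ChainRule : List E → List V → Set
    ChainRule es S = ratio (#matchings (es ∖ S)) (#matchings es) ≡ prodℚ (map (λ u → Prob (es ∖ below u S) u) S)

    chain-rule-peel : (es : List E) (S : List V) (m : V) → Unique S → m ∈ S → IsMax m S →
                      ChainRule es (S ─ m) → ChainRule es S
    chain-rule-peel es S m uS m∈S max IH = sym (begin
      prodℚ (map f S)                    ≡⟨ prodℚ-↭ (↭-map⁺ f (↭-∷─ uS m∈S)) ⟩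
      f m ℚ.* prodℚ (map f (S ─ m))
        ≡⟨ cong₂ ℚ._*_ f-m (trans (cong prodℚ (map-cong-∈ f f′ (S ─ m) f≡f′)) (sym IH)) ⟩
      ratio (#matchings (es ∖ S)) (#matchings (es ∖ (S ─ m))) ℚ.* ratio (#matchings (es ∖ (S ─ m))) (#matchings es)
                                         ≡⟨ ratio-trans _ _ _ {{#matchings-nonZero (es ∖ (S ─ m))}} ⟩
      ratio (#matchings (es ∖ S)) (#matchings es) ∎)
      where
      f f′ : V → ℚ
      f  u = Prob (es ∖ below u S) u
      f′ u = Prob (es ∖ below u (S ─ m)) u
      f-m : f m ≡ ratio (#matchings (es ∖ S)) (#matchings (es ∖ (S ─ m)))
      f-m = trans (Prob≡ratio (es ∖ below m S) m) (cong₂ (λ l l′ → ratio (#matchings l) (#matchings l′))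
              (trans (cong (_∖ (m ∷ [])) (∖-below-max es max)) (∖-─-∷ es m∈S)) (∖-below-max es max))
      f≡f′ : ∀ u → u ∈ S ─ m → f u ≡ f′ u
      f≡f′ u u∈ = cong (λ l → Prob l u) (∖-below-─ es max u∈)

    chain-rule-acc : (es : List E) (S : List V) → Unique S → Acc _<_ (length S) → ChainRule es S
    chain-rule-acc es [] _ _ =
      trans (cong (λ l → ratio (#matchings l) (#matchings es)) (∖-[] es)) (ratio-self _ {{#matchings-nonZero es}})
    chain-rule-acc es (x ∷ xs) uS (acc rs) =
      let (m , m∈S , max) = maximum x xs in
      chain-rule-peel es (x ∷ xs) m uS m∈S max (chain-rule-acc es ((x ∷ xs) ─ m) (─-unique m uS) (rs (length-─ m∈S)))

    chain-rule : (es : List E) (S : List V) → Unique S → ChainRule es S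
    chain-rule es S uS = chain-rule-acc es S uS (<-wellFounded (length S))

module _ {n : ℕ} where

  ∈members⁺ : (e : Subset n) {u : Fin n} → u ∈ₛ e → u ∈ members e
  ∈members⁺ e {u} h = MP.∈-filter⁺ (λ i → lookup e i ≟ᵇ true) (MP.∈-allFin u) (VecP.[]=⇒lookup h)

  ∈members⁻ : (e : Subset n) {u : Fin n} → u ∈ members e → u ∈ₛ e
  ∈members⁻ e {u} h = VecP.lookup⇒[]= u e (proj₂ (MP.∈-filter⁻ (λ i → lookup e i ≟ᵇ true) {xs = allFin n} h))

  members-unique : (e : Subset n) → Unique (members e)
  members-unique e = Uniqueₚ.filter⁺ (λ i → lookup e i ≟ᵇ true) (Uniqueₚ.allFin⁺ n)

  others : Fin n → Subset n → List (Fin n)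
  others a e = filter (λ u → ¬? (u ≟V a)) (members e)

  ∈others⁺ : (a : Fin n) (e : Subset n) {u : Fin n} → u ∈ₛ e → u ≢ a → u ∈ others a e
  ∈others⁺ a e h u≢a = MP.∈-filter⁺ (λ u → ¬? (u ≟V a)) (∈members⁺ e h) u≢a

  ∈others⁻ : (a : Fin n) (e : Subset n) {u : Fin n} → u ∈ others a e → u ∈ₛ e × u ≢ a
  ∈others⁻ a e h = let (u∈ , u≢a) = MP.∈-filter⁻ (λ u → ¬? (u ≟V a)) h in ∈members⁻ e u∈ , u≢a

  others-unique : (a : Fin n) (e : Subset n) → Unique (others a e)
  others-unique a e = Uniqueₚ.filter⁺ (λ u → ¬? (u ≟V a)) (members-unique e)

module _ {n : ℕ} where

  Step : Set
  Step = Subset n × Fin n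

  _++ʷ_ : Walk n → List Step → Walk n
  (v , st) ++ʷ r = (v , st ++ r)

  len : Walk n → ℕ
  len (v , st) = length st

  _≼_ : Walk n → Walk n → Set
  U ≼ Z = Σ (List Step) λ r → Z ≡ U ++ʷ r

  ≼-refl : (U : Walk n) → U ≼ U
  ≼-refl (u , su) = [] , cong (u ,_) (sym (LP.++-identityʳ su))

  ≼-trans : {A B C : Walk n} → A ≼ B → B ≼ C → A ≼ C
  ≼-trans {u , sa} (r , refl) (r′ , refl) = r ++ r′ , cong (u ,_) (LP.++-assoc sa r r′)

  ≼-⊕ : (W : Walk n) (s : Step) → W ≼ (W ⊕ s)
  ≼-⊕ W s = s ∷ [] , refl

  len-⊕ : (W : Walk n) (s : Step) → len (W ⊕ s) ≡ suc (len W)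
  len-⊕ (u , su) s = trans (LP.length-++ su) (NP.+-comm (length su) 1)

  len-mono : {A B : Walk n} → A ≼ B → len A ≤ len B
  len-mono {u , sa} (r , refl) = NP.≤-trans (NP.m≤m+n (length sa) (length r)) (NP.≤-reflexive (sym (LP.length-++ sa)))

  ≼-same-len : {A B Z : Walk n} → A ≼ Z → B ≼ Z → len A ≡ len B → A ≡ B
  ≼-same-len {u , sa} {u′ , sb} (r , refl) (r′ , e) |A|≡|B| with cong proj₁ e
  ... | refl = cong (u ,_) (proj₁ (++-injective sa sb r r′ (cong proj₂ e) |A|≡|B|))

  ≼-antisym : {A B : Walk n} → A ≼ B → B ≼ A → A ≡ B
  ≼-antisym A≼B B≼A = ≼-same-len A≼B (≼-refl _) (NP.≤-antisym (len-mono A≼B) (len-mono B≼A))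

  ≼-step : {W Z : Walk n} → W ≼ Z → W ≢ Z → Σ Step λ s → (W ⊕ s) ≼ Z
  ≼-step {u , su} ([]    , refl) W≢Z = ⊥-elim (W≢Z (cong (u ,_) (sym (LP.++-identityʳ su))))
  ≼-step {u , su} (s ∷ r , refl) _   = s , r , cong (u ,_) (sym (LP.++-assoc su (s ∷ []) r))

  ⊕-injective : (W : Walk n) {s s′ : Step} → W ⊕ s ≡ W ⊕ s′ → s ≡ s′
  ⊕-injective (u , su) eq = LP.∷-injectiveˡ (proj₂ (++-injective su su _ _ (cong proj₂ eq) refl))

  private
    _≟st_ : DecidableEquality Step
    _≟st_ = ×-≡-dec _≟S_ _≟V_

    isPrefixᵇ-∷ : (u w : Fin n) (x y : Step) (xs ys : List Step) →
      isPrefixᵇ (u , x ∷ xs) (w , y ∷ ys) ≡ does (x ≟st y) ∧ isPrefixᵇ (u , xs) (w , ys)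
    isPrefixᵇ-∷ u w x y xs ys with does (u ≟V w)
    ... | true  = refl
    ... | false = sym (∧-zeroʳ _)

  isPrefixᵇ-sound : (U Z : Walk n) → isPrefixᵇ U Z ≡ true → U ≼ Z
  isPrefixᵇ-sound (u , su) (w , sw) = sound su sw
    where
    sound : (su sw : List Step) → isPrefixᵇ (u , su) (w , sw) ≡ true → (u , su) ≼ (w , sw)
    sound [] sw h with u ≟V w
    ... | yes refl = sw , refl
    sound (x ∷ xs) [] h with does (u ≟V w)
    sound (x ∷ xs) [] () | true
    sound (x ∷ xs) [] () | false
    sound (x ∷ xs) (y ∷ ys) h with ∧-true⁻ {does (x ≟st y)} (trans (sym (isPrefixᵇ-∷ u w x y xs ys)) h)
    ... | x≟y , rest with sound xs ys rest | x ≟st y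
    ...   | r , refl | yes refl = r , refl

  isPrefixᵇ-complete : (U : Walk n) (r : List Step) → isPrefixᵇ U (U ++ʷ r) ≡ true
  isPrefixᵇ-complete (u , [])     r = cong (_∧ true) (dec-true (u ≟V u) refl)
  isPrefixᵇ-complete (u , x ∷ xs) r =
    trans (isPrefixᵇ-∷ u u x x xs (xs ++ r)) (cong₂ _∧_ (dec-true (x ≟st x) refl) (isPrefixᵇ-complete (u , xs) r))

  endW-⊕ : (W : Walk n) (s : Step) → endW (W ⊕ s) ≡ proj₂ s
  endW-⊕ (a , st) s = go a st
    where
    go : (a : Fin n) (st : List Step) → endW ((a , st) ⊕ s) ≡ proj₂ s
    go a []             = refl
    go a ((e , w) ∷ st) = go w st

module TreeRecursion {k n : ℕ} (H : KGraph k n) (_≺_ : Rel (Fin n) 0ℓ) (ET : List (WalkTree.TEdge H _≺_)) where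
  open WalkTree H _≺_ using (TEdge; tverts; subtree; ProbT; _∈ᵂ_)
  open MatchingCounts (_≟W_ {n}) tverts
  open Membershipᵇ (_≟W_ {n}) using (∈ᵇ⁻; ∉ᵇ⁺; ∉ᵇ⁻)

  apex : TEdge → Walk n
  apex = proj₁

  children : Walk n → Subset n → List (Walk n)
  children W e = map (λ u → W ⊕ (e , u)) (others (endW W) e)

  _⋖_ : Walk n → Walk n → Set
  W ⋖ U = Σ Step λ s → U ≡ W ⊕ s

  ⋖-len : {W U : Walk n} → W ⋖ U → len U ≡ suc (len W)
  ⋖-len {W} (s , refl) = len-⊕ W s

  ∈children⇒⋖ : (W : Walk n) (e : Subset n) {U : Walk n} → U ∈ children W e → W ⋖ U
  ∈children⇒⋖ W e U∈ with MP.∈-map⁻ (λ u → W ⊕ (e , u)) U∈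
  ... | u , _ , refl = (e , u) , refl

  apex≼ : (E : TEdge) {Z : Walk n} → Z ∈ tverts E → apex E ≼ Z
  apex≼ (W , e) (here refl) = ≼-refl W
  apex≼ (W , e) (there Z∈) with ∈children⇒⋖ W e Z∈
  ... | s , refl = ≼-⊕ W s

  inSubtree : Walk n → TEdge → Bool
  inSubtree W E = allᵇ (isPrefixᵇ W) (tverts E)

  inSubtree⁻ : (W : Walk n) (E : TEdge) → inSubtree W E ≡ true → W ≼ apex E
  inSubtree⁻ W E h = isPrefixᵇ-sound W (apex E) (allᵇ⁻ (isPrefixᵇ W) (tverts E) h (apex E) (here refl))

  inSubtree⁺ : (W : Walk n) (E : TEdge) → W ≼ apex E → inSubtree W E ≡ true
  inSubtree⁺ W E W≼ = allᵇ⁺ _ (tverts E) λ Z Z∈ → let (r , eq) = ≼-trans W≼ (apex≼ E Z∈) in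
    subst (λ Z → isPrefixᵇ W Z ≡ true) (sym eq) (isPrefixᵇ-complete W r)

  apex-of-member : (W : Walk n) (E : TEdge) → W ≼ apex E → W ∈ tverts E → apex E ≡ W
  apex-of-member W E W≼ W∈ = sym (≼-antisym W≼ (apex≼ E W∈))

  ⋖-≼-unique : {W U U′ Z : Walk n} → W ⋖ U → W ⋖ U′ → U ≼ Z → U′ ≼ Z → U ≡ U′
  ⋖-≼-unique W⋖U W⋖U′ U≼Z U′≼Z = ≼-same-len U≼Z U′≼Z (trans (⋖-len W⋖U) (sym (⋖-len W⋖U′)))

  ⋖-≼-apex : {W U : Walk n} → W ⋖ U → (E : TEdge) → U ≼ apex E → W ≼ apex E × ¬ (W ∈ tverts E)
  ⋖-≼-apex {W} (s , refl) E U≼ = ≼-trans (≼-⊕ W s) U≼ , λ W∈ →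
    NP.<-irrefl refl (NP.≤-trans (NP.≤-reflexive (sym (len-⊕ W s))) (len-mono (≼-trans U≼ (apex≼ E W∈))))

  ⋖-∈-apex : {W U : Walk n} → W ⋖ U → (E : TEdge) → W ≼ apex E → ¬ (W ∈ tverts E) → U ∈ tverts E → U ≼ apex E
  ⋖-∈-apex {W} {U} W⋖U E W≼ W∉ U∈ with ≼-step W≼ (λ W≡ → W∉ (subst (_∈ tverts E) (sym W≡) (here refl)))
  ... | s , W⊕s≼ = subst (_≼ apex E) (⋖-≼-unique (s , refl) W⋖U (≼-trans W⊕s≼ (apex≼ E U∈)) (≼-refl U)) W⊕s≼

  ⋖-shared-vertex : {W U Z : Walk n} → W ⋖ U → (E E′ : TEdge) → U ≼ apex E → W ≼ apex E′ → ¬ (W ∈ tverts E′) →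
                    Z ∈ tverts E → Z ∈ tverts E′ → U ≼ apex E′
  ⋖-shared-vertex {W} W⋖U E E′ U≼ W≼ W∉ Z∈ Z∈′
    with ≼-step W≼ (λ W≡ → W∉ (subst (_∈ tverts E′) (sym W≡) (here refl)))
  ... | s , W⊕s≼ = subst (_≼ apex E′) (sym (⋖-≼-unique W⋖U (s , refl)
          (≼-trans U≼ (apex≼ E Z∈)) (≼-trans W⊕s≼ (apex≼ E′ Z∈′)))) W⊕s≼

  -- T(W) minus W splits into the subtrees T(U) of the children U along e and the remaining edges
  module AtEdge (W : Walk n) (e : Subset n) where
    Us : List (Walk n)
    Us = children W e

    strictlyBelow inChildSubtree outside : TEdge → Bool
    strictlyBelow E  = inSubtree W E ∧ misses (W ∷ []) E
    inChildSubtree E = anyᵇ (λ U → inSubtree U E) Us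
    outside E        = strictlyBelow E ∧ not (inChildSubtree E)

    strictlyBelowChild : Walk n → TEdge → Bool
    strictlyBelowChild U E = inSubtree U E ∧ misses (U ∷ []) E

    strictlyBelow⁻ : (E : TEdge) → strictlyBelow E ≡ true → W ≼ apex E × ¬ (W ∈ tverts E)
    strictlyBelow⁻ E h with ∧-true⁻ h
    ... | h₁ , h₂ = inSubtree⁻ W E h₁ , ∉ᵇ⁻ W (tverts E) (not-true⁻ (proj₁ (∧-true⁻ h₂)))

    strictlyBelow⁺ : (E : TEdge) → W ≼ apex E → ¬ (W ∈ tverts E) → strictlyBelow E ≡ true
    strictlyBelow⁺ E W≼ W∉ = ∧-true⁺ (inSubtree⁺ W E W≼) (∧-true⁺ (not-true⁺ (∉ᵇ⁺ W (tverts E) W∉)) refl)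

    child⇒strictlyBelow : ∀ {U} → U ∈ Us → (E : TEdge) → inSubtree U E ≡ true → strictlyBelow E ≡ true
    child⇒strictlyBelow U∈ E h =
      let (W≼ , W∉) = ⋖-≼-apex (∈children⇒⋖ W e U∈) E (inSubtree⁻ _ E h) in strictlyBelow⁺ E W≼ W∉

    strictlyBelow-split : (E : TEdge) → strictlyBelow E ≡ inChildSubtree E ∨ outside E
    strictlyBelow-split E = bool-ext to from
      where
      to : strictlyBelow E ≡ true → inChildSubtree E ∨ outside E ≡ true
      to h with inChildSubtree E
      ... | true  = refl
      ... | false = ∧-true⁺ h refl
      from : inChildSubtree E ∨ outside E ≡ true → strictlyBelow E ≡ true
      from h with ∨-true⁻ {inChildSubtree E} h
      ... | inj₁ a = let (U , U∈ , hU) = anyᵇ⁻ (λ U → inSubtree U E) Us a in child⇒strictlyBelow U∈ E hU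
      ... | inj₂ o = proj₁ (∧-true⁻ o)

    children-disjoint : ∀ U U′ E → U ∈ Us → U′ ∈ Us → E ∈ ET →
                        inSubtree U E ≡ true → inSubtree U′ E ≡ true → U ≡ U′
    children-disjoint U U′ E U∈ U′∈ _ h h′ =
      ⋖-≼-unique (∈children⇒⋖ W e U∈) (∈children⇒⋖ W e U′∈) (inSubtree⁻ U E h) (inSubtree⁻ U′ E h′)

    outside-exclusive : ∀ U → U ∈ Us → Exclusive (inSubtree U) outside ET
    outside-exclusive U U∈ E _ h rewrite anyᵇ⁺ (λ U → inSubtree U E) Us U U∈ h = ∧-zeroʳ (strictlyBelow E)

    children-separated : ∀ U U′ → U ∈ Us → U′ ∈ Us → U ≢ U′ → Separated (inSubtree U) (inSubtree U′) ET
    children-separated U U′ U∈ U′∈ U≢U′ E E′ _ _ h h′ = disjointᵇ⁺ E E′ λ Z Z∈ Z∈′ →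
      U≢U′ (⋖-≼-unique (∈children⇒⋖ W e U∈) (∈children⇒⋖ W e U′∈)
                       (≼-trans (inSubtree⁻ U E h) (apex≼ E Z∈)) (≼-trans (inSubtree⁻ U′ E′ h′) (apex≼ E′ Z∈′)))

    outside-separated : ∀ U → U ∈ Us → Separated (inSubtree U) outside ET
    outside-separated U U∈ E E′ _ _ h o = disjointᵇ⁺ E E′ λ Z Z∈ Z∈′ →
      let (W≼ , W∉) = strictlyBelow⁻ E′ (proj₁ (∧-true⁻ o))
          U≼E′ = ⋖-shared-vertex (∈children⇒⋖ W e U∈) E E′ (inSubtree⁻ U E h) W≼ W∉ Z∈ Z∈′
      in true≢false (trans (sym (anyᵇ⁺ (λ U → inSubtree U E′) Us U U∈ (inSubtree⁺ U E′ U≼E′)))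
                           (not-true⁻ (proj₂ (∧-true⁻ {strictlyBelow E′} o))))

    missesChildren⁺ : (E : TEdge) → strictlyBelow E ≡ true → (∀ U → U ∈ Us → ¬ (U ∈ tverts E)) →
                      inSubtree W E ∧ misses (W ∷ Us) E ≡ true
    missesChildren⁺ E below none with ∧-true⁻ {inSubtree W E} below
    ... | inW , W∉ = ∧-true⁺ inW (∧-true⁺ (proj₁ (∧-true⁻ W∉))
                                          (allᵇ⁺ _ Us λ U U∈ → not-true⁺ (∉ᵇ⁺ U (tverts E) (none U U∈))))

    missesChildren-split : (E : TEdge) →
      inSubtree W E ∧ misses (W ∷ Us) E ≡ anyᵇ (λ U → strictlyBelowChild U E) Us ∨ outside E
    missesChildren-split E = bool-ext to from
      where
      to : inSubtree W E ∧ misses (W ∷ Us) E ≡ true → anyᵇ (λ U → strictlyBelowChild U E) Us ∨ outside E ≡ true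
      to h with ∧-true⁻ {inSubtree W E} h
      ... | inW , rest with ∧-true⁻ {not (W ∈ᵂ tverts E)} rest | true-or-false (inChildSubtree E)
      ...   | W∉ , none | inj₁ a = let (U , U∈ , hU) = anyᵇ⁻ (λ U → inSubtree U E) Us a in
        cong (_∨ outside E) (anyᵇ⁺ (λ U → strictlyBelowChild U E) Us U U∈
                                    (∧-true⁺ hU (∧-true⁺ (allᵇ⁻ _ Us none U U∈) refl)))
      ...   | W∉ , none | inj₂ a = trans (cong (anyᵇ (λ U → strictlyBelowChild U E) Us ∨_)
                                      (∧-true⁺ {strictlyBelow E} (∧-true⁺ inW (∧-true⁺ W∉ refl)) (not-true⁺ a)))
                                      (∨-zeroʳ _)
      from : anyᵇ (λ U → strictlyBelowChild U E) Us ∨ outside E ≡ true → inSubtree W E ∧ misses (W ∷ Us) E ≡ true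
      from h with ∨-true⁻ {anyᵇ (λ U → strictlyBelowChild U E) Us} h
      ... | inj₁ a = let (U , U∈ , hU) = anyᵇ⁻ (λ U → strictlyBelowChild U E) Us a
                         (inU , U∉) = ∧-true⁻ hU in
        missesChildren⁺ E (child⇒strictlyBelow U∈ E inU) λ U′ U′∈ U′∈E →
          ∉ᵇ⁻ U (tverts E) (not-true⁻ (proj₁ (∧-true⁻ U∉)))
            (subst (_∈ tverts E) (⋖-≼-unique (∈children⇒⋖ W e U′∈) (∈children⇒⋖ W e U∈)
                                    (≼-refl U′) (≼-trans (inSubtree⁻ U E inU) (apex≼ E U′∈E))) U′∈E)
      ... | inj₂ o = let (below , notChild) = ∧-true⁻ o
                         (W≼ , W∉) = strictlyBelow⁻ E below in
        missesChildren⁺ E below λ U U∈ U∈E →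
          true≢false (trans (sym (anyᵇ⁺ (λ U → inSubtree U E) Us U U∈
                                   (inSubtree⁺ U E (⋖-∈-apex (∈children⇒⋖ W e U∈) E W≼ W∉ U∈E))))
                            (not-true⁻ notChild))

    children-unique : Unique Us
    children-unique = Uniqueₚ.map⁺ (λ eq → proj₂ (×-≡,≡←≡ (⊕-injective W eq))) (others-unique (endW W) e)

    #matchings-T∖W : #matchings (subtree ET W ∖ (W ∷ []))
                     ≡ product (map (λ U → #matchings (subtree ET U)) Us) * #matchings (filterᵇ outside ET)
    #matchings-T∖W = trans (cong #matchings (trans (filterᵇ-filterᵇ (misses (W ∷ [])) (inSubtree W) ET)
                                                   (filterᵇ-cong _ _ ET (λ E _ → strictlyBelow-split E))))
      (#matchings-⋁ inSubtree outside Us ET children-unique children-disjoint outside-exclusive children-separated outside-separated)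

    #matchings-T∖E : #matchings (subtree ET W ∖ (W ∷ Us))
                     ≡ product (map (λ U → #matchings (subtree ET U ∖ (U ∷ []))) Us) * #matchings (filterᵇ outside ET)
    #matchings-T∖E = trans (cong #matchings (trans (filterᵇ-filterᵇ (misses (W ∷ Us)) (inSubtree W) ET)
                                                   (filterᵇ-cong _ _ ET (λ E _ → missesChildren-split E))))
      (trans (#matchings-⋁ strictlyBelowChild outside Us ET children-unique
               (λ U U′ E U∈ U′∈ E∈ h h′ → children-disjoint U U′ E U∈ U′∈ E∈ (inU U E h) (inU U′ E h′))
               (λ U U∈ E E∈ h → outside-exclusive U U∈ E E∈ (inU U E h))
               (λ U U′ U∈ U′∈ U≢U′ E E′ E∈ E′∈ h h′ →
                  children-separated U U′ U∈ U′∈ U≢U′ E E′ E∈ E′∈ (inU U E h) (inU U′ E′ h′))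
               (λ U U∈ E E′ E∈ E′∈ h → outside-separated U U∈ E E′ E∈ E′∈ (inU U E h)))
             (cong (λ ms → product ms * #matchings (filterᵇ outside ET))
                   (LP.map-cong (λ U → cong #matchings (sym (filterᵇ-filterᵇ (misses (U ∷ [])) (inSubtree U) ET))) Us)))
      where
      inU : ∀ U E → strictlyBelowChild U E ≡ true → inSubtree U E ≡ true
      inU U E h = proj₁ (∧-true⁻ {inSubtree U E} h)

    child≢W : ∀ {U} → U ∈ Us → U ≢ W
    child≢W U∈ U≡W with ∈children⇒⋖ W e U∈
    ... | s , refl = NP.<-irrefl refl (NP.≤-reflexive (trans (sym (len-⊕ W s)) (cong len U≡W)))

    others≡children : filter (λ U → ¬? (U ≟W W)) (tverts (W , e)) ≡ Us
    others≡children = trans (LP.filter-reject (λ U → ¬? (U ≟W W)) (λ W≢W → W≢W refl))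
                            (LP.filter-all (λ U → ¬? (U ≟W W)) (All.tabulate child≢W))

    ratio-at-edge : ratio (#matchings (subtree ET W ∖ tverts (W , e))) (#matchings (subtree ET W ∖ (W ∷ [])))
                    ≡ prodℚ (map (λ U → ProbT (subtree ET U) U) (filter (λ U → ¬? (U ≟W W)) (tverts (W , e))))
    ratio-at-edge = begin
      ratio (#matchings (subtree ET W ∖ (W ∷ Us))) (#matchings (subtree ET W ∖ (W ∷ [])))
        ≡⟨ cong₂ ratio #matchings-T∖E #matchings-T∖W ⟩
      ratio (product (map a Us) * o) (product (map b Us) * o)
        ≡⟨ ratio-cancelʳ _ _ o {{#matchings-nonZero (filterᵇ outside ET)}} ⟩
      ratio (product (map a Us)) (product (map b Us))
        ≡⟨ sym (prodℚ-ratio a b Us) ⟩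
      prodℚ (map (λ U → ratio (a U) (b U)) Us)
        ≡⟨ cong prodℚ (LP.map-cong (λ U → sym (Prob≡ratio (subtree ET U) U)) Us) ⟩
      prodℚ (map (λ U → ProbT (subtree ET U) U) Us)
        ≡⟨ cong (λ Vs → prodℚ (map (λ U → ProbT (subtree ET U) U) Vs)) (sym others≡children) ⟩
      prodℚ (map (λ U → ProbT (subtree ET U) U) (filter (λ U → ¬? (U ≟W W)) (tverts (W , e)))) ∎
      where
      open ≡-Reasoning
      a b : Walk n → ℕ
      a U = #matchings (subtree ET U ∖ (U ∷ []))
      b U = #matchings (subtree ET U)
      o = #matchings (filterᵇ outside ET)

  ratio-at-apex : (W : Walk n) (E : TEdge) → apex E ≡ W →
    ratio (#matchings (subtree ET W ∖ tverts E)) (#matchings (subtree ET W ∖ (W ∷ [])))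
    ≡ prodℚ (map (λ U → ProbT (subtree ET U) U) (filter (λ U → ¬? (U ≟W W)) (tverts E)))
  ratio-at-apex W (.W , e) refl = AtEdge.ratio-at-edge W e

  Prob-subtree-recursion : (W : Walk n) → ProbT (subtree ET W) W ≡
    inv (1ℚ ℚ.+ sumℚ (map (λ E → prodℚ (map (λ U → ProbT (subtree ET U) U) (filter (λ U → ¬? (U ≟W W)) (tverts E))))
                          (filterᵇ (λ E → W ∈ᵂ tverts E) (subtree ET W))))
  Prob-subtree-recursion W = trans (Prob-recursion (subtree ET W) W)
    (cong (λ rs → inv (1ℚ ℚ.+ sumℚ rs)) (map-cong-∈ _ _ (filterᵇ (λ E → W ∈ᵂ tverts E) (subtree ET W)) at-W))
    where
    at-W : ∀ E → E ∈ filterᵇ (λ E → W ∈ᵂ tverts E) (subtree ET W) →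
           ratio (#matchings (subtree ET W ∖ tverts E)) (#matchings (subtree ET W ∖ (W ∷ [])))
           ≡ prodℚ (map (λ U → ProbT (subtree ET U) U) (filter (λ U → ¬? (U ≟W W)) (tverts E)))
    at-W E E∈ = let (E∈T , W∈E) = ∈-filterᵇ⁻ _ (subtree ET W) E∈ in
      ratio-at-apex W E (apex-of-member W E (inSubtree⁻ W E (proj₂ (∈-filterᵇ⁻ (inSubtree W) ET E∈T)))
                                            (∈ᵇ⁻ W (tverts E) W∈E))

module ConflictFree {k n : ℕ} (H : KGraph k n) (_≺_ : Rel (Fin n) 0ℓ) (sto : IsStrictTotalOrder _≡_ _≺_) where
  open WalkTree H _≺_ using (InC; CF; IsCFW)
  open IsStrictTotalOrder sto using (irrefl) renaming (_<?_ to _≺?_)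
  open MatchingCounts.Ordered _≟V_ members _≺_ sto using (below) public

  Cstep : Fin n → Subset n → Fin n → List (Fin n)
  Cstep a e b = a ∷ below b (others a e)

  Cstep⁻ : ∀ a e b {u} → u ∈ Cstep a e b → InC e a b u
  Cstep⁻ a e b (here refl) = inj₂ refl
  Cstep⁻ a e b (there h) with MP.∈-filter⁻ (_≺? b) h
  ... | u∈ , u≺b with ∈others⁻ a e u∈
  ...   | u∈e , u≢a = inj₁ (u∈e , u≢a , (λ { refl → irrefl refl u≺b }) , u≺b)

  Cstep⁺ : ∀ a e b {u} → InC e a b u → u ∈ Cstep a e b
  Cstep⁺ a e b (inj₂ refl) = here refl
  Cstep⁺ a e b (inj₁ (u∈e , u≢a , _ , u≺b)) = there (MP.∈-filter⁺ (_≺? b) (∈others⁺ a e u∈e u≢a) u≺b)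

  -- ⋃_j C_j along a walk; D accumulates the sets of the prefix already traversed, which ends at a
  conflictsFrom : Fin n → List (Fin n) → List Step → List (Fin n)
  conflictsFrom a D []             = D
  conflictsFrom a D ((e , b) ∷ st) = conflictsFrom b (D ++ Cstep a e b) st

  conflicts : Walk n → List (Fin n)
  conflicts (v₀ , st) = conflictsFrom v₀ [] st

  conflicts-⊕ : (W : Walk n) (e : Subset n) (u : Fin n) → conflicts (W ⊕ (e , u)) ≡ conflicts W ++ Cstep (endW W) e u
  conflicts-⊕ (v₀ , st) e u = go v₀ [] st
    where
    go : ∀ a D st → conflictsFrom a D (st ++ (e , u) ∷ []) ≡ conflictsFrom a D st ++ Cstep (endW (a , st)) e u
    go a D []              = refl
    go a D ((e′ , w) ∷ st) = go w (D ++ Cstep a e′ w) st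

  -- the arguments of CF along a walk
  record State : Set₁ where
    constructor state
    field
      last    : Fin n
      blocked : Fin n → Set
      visited : List (Fin n)
      used    : List (Subset n)
  open State

  advance : State → Step → State
  advance s (e , w) = state w (λ u → blocked s u ⊎ InC e (last s) w u) (w ∷ visited s) (e ∷ used s)

  run : State → List Step → State
  run s []       = s
  run s (x ∷ st) = run (advance s x) st

  CFFrom : State → List Step → Set
  CFFrom s = CF (last s) (blocked s) (visited s) (used s)

  StepOK : State → Step → Set
  StepOK s (e , w) = e ∈ edges H × last s ∈ₛ e × w ∈ₛ e × ¬ (w ∈ visited s) × ¬ (e ∈ used s) ×
                     (∀ u → u ∈ₛ e → ¬ blocked s u)

  CF-snoc⁻ : ∀ s st e u → CFFrom s (st ++ (e , u) ∷ []) → CFFrom s st × StepOK (run s st) (e , u)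
  CF-snoc⁻ s [] e u (a , b , c , d , f , g , _) = tt , (a , b , c , d , f , g)
  CF-snoc⁻ s ((e′ , w) ∷ st) e u (a , b , c , d , f , g , r) =
    let (r′ , ok) = CF-snoc⁻ (advance s (e′ , w)) st e u r in (a , b , c , d , f , g , r′) , ok

  CF-snoc⁺ : ∀ s st e u → CFFrom s st → StepOK (run s st) (e , u) → CFFrom s (st ++ (e , u) ∷ [])
  CF-snoc⁺ s [] e u _ (a , b , c , d , f , g) = a , b , c , d , f , g , tt
  CF-snoc⁺ s ((e′ , w) ∷ st) e u (a , b , c , d , f , g , r) ok =
    a , b , c , d , f , g , CF-snoc⁺ (advance s (e′ , w)) st e u r ok

  record Invariant (s : State) (D : List (Fin n)) : Set where
    field
      blocked⊆D       : ∀ u → blocked s u → u ∈ D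
      D⊆blocked       : ∀ u → u ∈ D → blocked s u
      last-visited    : last s ∈ visited s
      visited-blocked : ∀ w → w ∈ visited s → w ≡ last s ⊎ blocked s w
      used-blocked    : ∀ f → f ∈ used s → Σ (Fin n) λ w → w ∈ₛ f × blocked s w
      last-free       : ¬ blocked s (last s)

  invariant-advance : ∀ s D e w → Invariant s D → StepOK s (e , w) →
                      Invariant (advance s (e , w)) (D ++ Cstep (last s) e w)
  invariant-advance s D e w I (_ , p∈e , w∈e , w∉visited , _ , e-free) = record
    { blocked⊆D       = blocked′⊆D′
    ; D⊆blocked       = D′⊆blocked′
    ; last-visited    = here refl
    ; visited-blocked = visited′-blocked
    ; used-blocked    = used′-blocked
    ; last-free       = w-free
    }
    where
    open Invariant I
    p = last s
    blocked′⊆D′ : ∀ u → blocked s u ⊎ InC e p w u → u ∈ D ++ Cstep p e w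
    blocked′⊆D′ u (inj₁ b)   = MP.∈-++⁺ˡ (blocked⊆D u b)
    blocked′⊆D′ u (inj₂ InC) = MP.∈-++⁺ʳ D (Cstep⁺ p e w InC)
    D′⊆blocked′ : ∀ u → u ∈ D ++ Cstep p e w → blocked s u ⊎ InC e p w u
    D′⊆blocked′ u h = ⊎-map (D⊆blocked u) (Cstep⁻ p e w) (MP.∈-++⁻ D h)
    visited′-blocked : ∀ x → x ∈ w ∷ visited s → x ≡ w ⊎ (blocked s x ⊎ InC e p w x)
    visited′-blocked x (here refl) = inj₁ refl
    visited′-blocked x (there x∈)  = inj₂ ([ (λ x≡p → inj₂ (inj₂ x≡p)) , inj₁ ]′ (visited-blocked x x∈))
    used′-blocked : ∀ f → f ∈ e ∷ used s → Σ (Fin n) λ x → x ∈ₛ f × (blocked s x ⊎ InC e p w x)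
    used′-blocked f (here refl) = p , p∈e , inj₂ (inj₂ refl)
    used′-blocked f (there f∈)  = let (x , x∈f , bx) = used-blocked f f∈ in x , x∈f , inj₁ bx
    w-free : ¬ (blocked s w ⊎ InC e p w w)
    w-free (inj₁ bw) = e-free w w∈e bw
    w-free (inj₂ (inj₁ (_ , _ , w≢w , _))) = w≢w refl
    w-free (inj₂ (inj₂ refl)) = w∉visited last-visited

  invariant-run : ∀ s D st → Invariant s D → CFFrom s st →
                  Invariant (run s st) (conflictsFrom (last s) D st) × last (run s st) ≡ endW (last s , st)
  invariant-run s D [] I _ = I , refl
  invariant-run s D ((e , w) ∷ st) I (a , b , c , d , f , g , r) =
    invariant-run (advance s (e , w)) (D ++ Cstep (last s) e w) st (invariant-advance s D e w I (a , b , c , d , f , g)) r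

  root : Fin n → State
  root v₀ = state v₀ (λ _ → ⊥) (v₀ ∷ []) []

  invariant-root : ∀ v₀ → Invariant (root v₀) []
  invariant-root v₀ = record
    { blocked⊆D = λ _ () ; D⊆blocked = λ _ () ; last-visited = here refl
    ; visited-blocked = λ { w (here refl) → inj₁ refl } ; used-blocked = λ _ () ; last-free = λ () }

  module _ (v : Fin n) where

    invariant-CFW : (v₀ : Fin n) (st : List Step) → IsCFW v (v₀ , st) →
                    Invariant (run (root v₀) st) (conflicts (v₀ , st)) × last (run (root v₀) st) ≡ endW (v₀ , st)
    invariant-CFW v₀ st (_ , cf) = invariant-run (root v₀) [] st (invariant-root v₀) cf

    end∉conflicts : (W : Walk n) → IsCFW v W → ¬ (endW W ∈ conflicts W)
    end∉conflicts (v₀ , st) cfw end∈ = last-free (subst (blocked (run (root v₀) st)) (sym last≡end) (D⊆blocked _ end∈))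
      where open Invariant (proj₁ (invariant-CFW v₀ st cfw))
            last≡end = proj₂ (invariant-CFW v₀ st cfw)

    extension⇒avoids-conflicts : (W : Walk n) (e : Subset n) (u : Fin n) → IsCFW v (W ⊕ (e , u)) →
                                 ∀ d → d ∈ conflicts W → ¬ (d ∈ₛ e)
    extension⇒avoids-conflicts (v₀ , st) e u (v₀≡v , cf) d d∈ d∈e =
      let (cf-st , (_ , _ , _ , _ , _ , e-free)) = CF-snoc⁻ (root v₀) st e u cf
      in e-free d d∈e (Invariant.D⊆blocked (proj₁ (invariant-CFW v₀ st (v₀≡v , cf-st))) d d∈)

    avoids-conflicts⇒extension : (W : Walk n) (e : Subset n) (u : Fin n) → IsCFW v W → e ∈ edges H → endW W ∈ₛ e →
      (∀ d → d ∈ conflicts W → ¬ (d ∈ₛ e)) → u ∈ₛ e → u ≢ endW W → IsCFW v (W ⊕ (e , u))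
    avoids-conflicts⇒extension (v₀ , st) e u (v₀≡v , cf) e∈H end∈e e-free u∈e u≢end =
      v₀≡v , CF-snoc⁺ (root v₀) st e u cf (e∈H , subst (_∈ₛ e) (sym last≡end) end∈e , u∈e , u-unvisited , e-unused ,
                                            λ w w∈e bw → e-free w (blocked⊆D w bw) w∈e)
      where
      open Invariant (proj₁ (invariant-CFW v₀ st (v₀≡v , cf)))
      last≡end = proj₂ (invariant-CFW v₀ st (v₀≡v , cf))
      u-unvisited : ¬ (u ∈ visited (run (root v₀) st))
      u-unvisited u∈ = [ (λ u≡last → u≢end (trans u≡last last≡end)) , (λ bu → e-free u (blocked⊆D u bu) u∈e) ]′
                         (visited-blocked u u∈)
      e-unused : ¬ (e ∈ used (run (root v₀) st))
      e-unused e∈ = let (w , w∈e , bw) = used-blocked e e∈ in e-free w (blocked⊆D w bw) w∈e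

module Main {k n : ℕ} (H : KGraph k n) (v : Fin n) (_≺_ : Rel (Fin n) 0ℓ) (sto : IsStrictTotalOrder _≡_ _≺_)
            (ET : List (WalkTree.TEdge H _≺_)) (ET-unique : Unique ET)
            (ET-complete : ∀ E → (E ∈ ET) ⇔ WalkTree.IsTEdge H _≺_ v E) where
  open WalkTree H _≺_ using (TEdge; IsTEdge; IsCFW; tverts; subtree; ProbT; _∈ᵂ_)
  open ConflictFree H _≺_ sto
  open MatchingCounts.Ordered (_≟V_ {n}) members _≺_ sto using (chain-rule)
  open TreeRecursion H _≺_ ET
    using (apex; inSubtree; inSubtree⁺; inSubtree⁻; apex-of-member; children; Prob-subtree-recursion; module AtEdge)
  open MatchingCounts (_≟V_ {n}) members
  open Membershipᵇ (_≟V_ {n}) using () renaming (∈ᵇ⁺ to ∈ᵇ⁺ᵥ; ∈ᵇ⁻ to ∈ᵇ⁻ᵥ; ∉ᵇ⁺ to ∉ᵇ⁺ᵥ; ∉ᵇ⁻ to ∉ᵇ⁻ᵥ)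
  open Membershipᵇ (_≟W_ {n}) using () renaming (∈ᵇ⁺ to ∈ᵇ⁺ʷ; ∈ᵇ⁻ to ∈ᵇ⁻ʷ)

  -- the edges of H still usable by conflict-free walks extending W
  available : Walk n → List (Subset n)
  available W = edges H ∖ conflicts W

  ∈available⁺ : (W : Walk n) (e : Subset n) → e ∈ edges H → (∀ d → d ∈ conflicts W → ¬ (d ∈ₛ e)) → e ∈ available W
  ∈available⁺ W e e∈H free = ∈-filterᵇ⁺ (misses (conflicts W)) (edges H) e∈H
    (allᵇ⁺ _ (conflicts W) λ d d∈ → not-true⁺ (∉ᵇ⁺ᵥ d (members e) (λ d∈e → free d d∈ (∈members⁻ e d∈e))))

  ∈available⁻ : (W : Walk n) (e : Subset n) → e ∈ available W → e ∈ edges H × (∀ d → d ∈ conflicts W → ¬ (d ∈ₛ e))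
  ∈available⁻ W e e∈ = let (e∈H , free) = ∈-filterᵇ⁻ (misses (conflicts W)) (edges H) e∈ in
    e∈H , λ d d∈ d∈e → ∉ᵇ⁻ᵥ d (members e) (not-true⁻ (allᵇ⁻ _ (conflicts W) free d d∈)) (∈members⁺ e d∈e)

  available-⊕ : (W : Walk n) (e : Subset n) (u : Fin n) →
    available (W ⊕ (e , u)) ≡ (available W ∖ (endW W ∷ [])) ∖ below u (others (endW W) e)
  available-⊕ W e u = trans (cong (edges H ∖_) (conflicts-⊕ W e u))
    (trans (sym (∖-++ (edges H) (conflicts W) (Cstep (endW W) e u)))
           (sym (∖-++ (available W) (endW W ∷ []) (below u (others (endW W) e)))))

  available∖edge : (W : Walk n) (e : Subset n) → endW W ∈ₛ e →
    available W ∖ members e ≡ (available W ∖ (endW W ∷ [])) ∖ others (endW W) e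
  available∖edge W e end∈e =
    trans (∖-cong (available W) (members e) (x ∷ others x e) ⊆ ⊇) (sym (∖-++ (available W) (x ∷ []) (others x e)))
    where
    x = endW W
    ⊆ : ∀ a → a ∈ members e → a ∈ x ∷ others x e
    ⊆ a a∈ with a ≟V x
    ... | yes refl = here refl
    ... | no a≢x   = there (∈others⁺ x e (∈members⁻ e a∈) a≢x)
    ⊇ : ∀ a → a ∈ x ∷ others x e → a ∈ members e
    ⊇ a (here refl) = ∈members⁺ e end∈e
    ⊇ a (there a∈)  = ∈members⁺ e (proj₁ (∈others⁻ x e a∈))

  atEnd : Walk n → Subset n → Bool
  atEnd W e = endW W ∈ᵇ members e

  atEnd⁻ : (W : Walk n) {e : Subset n} → e ∈ filterᵇ (atEnd W) (available W) → endW W ∈ₛ e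
  atEnd⁻ W {e} e∈ = ∈members⁻ e (∈ᵇ⁻ᵥ (endW W) (members e) (proj₂ (∈-filterᵇ⁻ (atEnd W) (available W) e∈)))

  edgeFactor : Walk n → Subset n → ℚ
  edgeFactor W e = prodℚ (map (λ u → Prob (available (W ⊕ (e , u))) u) (others (endW W) e))

  Prob-available-recursion : (W : Walk n) →
    Prob (available W) (endW W) ≡ inv (1ℚ ℚ.+ sumℚ (map (edgeFactor W) (filterᵇ (atEnd W) (available W))))
  Prob-available-recursion W = trans (Prob-recursion (available W) (endW W))
    (cong (λ rs → inv (1ℚ ℚ.+ sumℚ rs))
      (map-cong-∈ (λ e → ratio (#matchings (available W ∖ members e)) (#matchings (available W ∖ (x ∷ [])))) (edgeFactor W)
                  (filterᵇ (atEnd W) (available W)) at-e))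
    where
    x = endW W
    at-e : ∀ e → e ∈ filterᵇ (atEnd W) (available W) →
           ratio (#matchings (available W ∖ members e)) (#matchings (available W ∖ (x ∷ []))) ≡ edgeFactor W e
    at-e e e∈ = begin
      ratio (#matchings (available W ∖ members e)) (#matchings (available W ∖ (x ∷ [])))
        ≡⟨ cong (λ l → ratio (#matchings l) (#matchings (available W ∖ (x ∷ [])))) (available∖edge W e (atEnd⁻ W e∈)) ⟩
      ratio (#matchings ((available W ∖ (x ∷ [])) ∖ others x e)) (#matchings (available W ∖ (x ∷ [])))
        ≡⟨ chain-rule (available W ∖ (x ∷ [])) (others x e) (others-unique x e) ⟩
      prodℚ (map (λ u → Prob ((available W ∖ (x ∷ [])) ∖ below u (others x e)) u) (others x e))
        ≡⟨ cong prodℚ (LP.map-cong (λ u → cong (λ l → Prob l u) (sym (available-⊕ W e u))) (others x e)) ⟩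
      edgeFactor W e ∎
      where open ≡-Reasoning

  treeFactor : Walk n → TEdge → ℚ
  treeFactor W E = prodℚ (map (λ U → ProbT (subtree ET U) U) (filter (λ U → ¬? (U ≟W W)) (tverts E)))

  availableAt : Walk n → List (Subset n)
  availableAt W = filterᵇ (atEnd W) (available W)

  treeEdgesAt : Walk n → List TEdge
  treeEdgesAt W = filterᵇ (λ E → W ∈ᵂ tverts E) (subtree ET W)

  availableAt⇒∈ET : (W : Walk n) (e : Subset n) → IsCFW v W → e ∈ availableAt W → (W , e) ∈ ET
  availableAt⇒∈ET W e cfw e∈ = Equivalence.from (ET-complete (W , e))
    (cfw , e∈H , atEnd⁻ W e∈ , λ u u∈e u≢end → avoids-conflicts⇒extension v W e u cfw e∈H (atEnd⁻ W e∈) free u∈e u≢end)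
    where
    e∈H×free = ∈available⁻ W e (proj₁ (∈-filterᵇ⁻ (atEnd W) (available W) e∈))
    e∈H = proj₁ e∈H×free
    free = proj₂ e∈H×free

  ∈ET⇒availableAt : (W : Walk n) (e : Subset n) → IsCFW v W → (W , e) ∈ ET → e ∈ availableAt W
  ∈ET⇒availableAt W e cfw E∈ = ∈-filterᵇ⁺ (atEnd W) (available W) (∈available⁺ W e e∈H free)
                                  (∈ᵇ⁺ᵥ (endW W) (members e) (∈members⁺ e end∈e))
    where
    isT = Equivalence.to (ET-complete (W , e)) E∈
    e∈H = proj₁ (proj₂ isT)
    end∈e = proj₁ (proj₂ (proj₂ isT))
    free : ∀ d → d ∈ conflicts W → ¬ (d ∈ₛ e)
    free d d∈ d∈e with d ≟V endW W
    ... | yes refl = end∉conflicts v W cfw d∈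
    ... | no d≢end = extension⇒avoids-conflicts v W e d (proj₂ (proj₂ (proj₂ isT)) d d∈e d≢end) d d∈ d∈e

  edgesAt-↭ : (W : Walk n) → IsCFW v W → map (W ,_) (availableAt W) ↭ treeEdgesAt W
  edgesAt-↭ W cfw = ↭-from-set
    (Uniqueₚ.map⁺ (cong proj₂) (Uniqueₚ.filter⁺ _ (Uniqueₚ.filter⁺ _ (distinct H))))
    (Uniqueₚ.filter⁺ _ (Uniqueₚ.filter⁺ _ ET-unique))
    (λ E E∈ → let (e , e∈ , E≡) = MP.∈-map⁻ (W ,_) E∈ in subst (_∈ treeEdgesAt W) (sym E≡)
       (∈-filterᵇ⁺ _ (subtree ET W)
         (∈-filterᵇ⁺ (inSubtree W) ET (availableAt⇒∈ET W e cfw e∈) (inSubtree⁺ W (W , e) (≼-refl W)))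
                   (∈ᵇ⁺ʷ W (tverts (W , e)) (here refl))))
    (λ { E@(W₀ , e) E∈ →
       let (E∈T , W∈E) = ∈-filterᵇ⁻ _ (subtree ET W) E∈
           (E∈ET , W-below) = ∈-filterᵇ⁻ (inSubtree W) ET E∈T
           W₀≡W = apex-of-member W E (inSubtree⁻ W E W-below) (∈ᵇ⁻ʷ W (tverts E) W∈E)
       in subst (λ W₀ → (W₀ , e) ∈ map (W ,_) (availableAt W)) (sym W₀≡W)
            (MP.∈-map⁺ (W ,_) (∈ET⇒availableAt W e cfw (subst (λ W₀ → (W₀ , e) ∈ ET) W₀≡W E∈ET))) })

  ProbsAgree : Walk n → Set
  ProbsAgree W = Prob (available W) (endW W) ≡ ProbT (subtree ET W) W

  edgeFactor≡treeFactor : (W : Walk n) (e : Subset n) → (∀ u → u ∈ others (endW W) e → ProbsAgree (W ⊕ (e , u))) →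
                          edgeFactor W e ≡ treeFactor W (W , e)
  edgeFactor≡treeFactor W e children-agree = begin
    prodℚ (map (λ u → Prob (available (W ⊕ (e , u))) u) (others (endW W) e))
      ≡⟨ cong prodℚ (map-cong-∈ _ (λ u → ProbT (subtree ET (W ⊕ (e , u))) (W ⊕ (e , u))) (others (endW W) e)
                       (λ u u∈ → subst (λ z → Prob (available (W ⊕ (e , u))) z ≡ ProbT (subtree ET (W ⊕ (e , u))) (W ⊕ (e , u)))
                                        (endW-⊕ W (e , u)) (children-agree u u∈))) ⟩
    prodℚ (map (λ u → ProbT (subtree ET (W ⊕ (e , u))) (W ⊕ (e , u))) (others (endW W) e))
      ≡⟨ cong prodℚ (LP.map-∘ (others (endW W) e)) ⟩
    prodℚ (map (λ U → ProbT (subtree ET U) U) (children W e))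
      ≡⟨ cong (λ Us → prodℚ (map (λ U → ProbT (subtree ET U) U) Us)) (sym (AtEdge.others≡children W e)) ⟩
    treeFactor W (W , e) ∎
    where open ≡-Reasoning

  available-shrinks : (W : Walk n) (e : Subset n) (u : Fin n) → e ∈ availableAt W →
                      length (available (W ⊕ (e , u))) < length (available W)
  available-shrinks W e u e∈ rewrite available-⊕ W e u =
    NP.≤-<-trans (length-∖ (available W ∖ (endW W ∷ [])) (below u (others (endW W) e)))
                 (length-filterᵇ-< (misses (endW W ∷ [])) (available W) (proj₁ (∈-filterᵇ⁻ (atEnd W) (available W) e∈))
                                   (cong (λ b → not b ∧ true) (proj₂ (∈-filterᵇ⁻ (atEnd W) (available W) e∈))))

  probs-agree-acc : (W : Walk n) → IsCFW v W → Acc _<_ (length (available W)) → ProbsAgree W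
  probs-agree-acc W cfw (acc rs) = trans (Prob-available-recursion W)
    (trans (cong (λ z → inv (1ℚ ℚ.+ z)) sums≡) (sym (Prob-subtree-recursion W)))
    where
    child-CFW : ∀ e → e ∈ availableAt W → ∀ u → u ∈ others (endW W) e → IsCFW v (W ⊕ (e , u))
    child-CFW e e∈ u u∈ = let (e∈H , free) = ∈available⁻ W e (proj₁ (∈-filterᵇ⁻ (atEnd W) (available W) e∈)) in
      avoids-conflicts⇒extension v W e u cfw e∈H (atEnd⁻ W e∈) free
                                 (proj₁ (∈others⁻ (endW W) e u∈)) (proj₂ (∈others⁻ (endW W) e u∈))
    sums≡ : sumℚ (map (edgeFactor W) (availableAt W)) ≡ sumℚ (map (treeFactor W) (treeEdgesAt W))
    sums≡ = begin
      sumℚ (map (edgeFactor W) (availableAt W))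
        ≡⟨ cong sumℚ (map-cong-∈ (edgeFactor W) (λ e → treeFactor W (W , e)) (availableAt W) λ e e∈ →
             edgeFactor≡treeFactor W e λ u u∈ →
               probs-agree-acc (W ⊕ (e , u)) (child-CFW e e∈ u u∈) (rs (available-shrinks W e u e∈))) ⟩
      sumℚ (map (λ e → treeFactor W (W , e)) (availableAt W))
        ≡⟨ cong sumℚ (LP.map-∘ (availableAt W)) ⟩
      sumℚ (map (treeFactor W) (map (W ,_) (availableAt W)))
        ≡⟨ sumℚ-↭ (↭-map⁺ (treeFactor W) (edgesAt-↭ W cfw)) ⟩
      sumℚ (map (treeFactor W) (treeEdgesAt W)) ∎
      where open ≡-Reasoning

  probs-agree : (W : Walk n) → IsCFW v W → ProbsAgree W
  probs-agree W cfw = probs-agree-acc W cfw (<-wellFounded _)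

  available-root : available (v , []) ≡ edges H
  available-root = ∖-[] (edges H)

  subtree-root : subtree ET (v , []) ≡ ET
  subtree-root = filterᵇ-all (inSubtree (v , [])) ET λ E E∈ → inSubtree⁺ (v , []) E (root≼ E (Equivalence.to (ET-complete E) E∈))
    where
    root≼ : ∀ E → IsTEdge v E → (v , []) ≼ apex E
    root≼ ((v₀ , st) , e) ((v₀≡v , _) , _) = st , cong (_, st) v₀≡v

lemma4p2 : ∀ {k n : ℕ} (H : KGraph k n) (v : Fin n)
    (_≺_ : Rel (Fin n) 0ℓ) → IsStrictTotalOrder _≡_ _≺_ →
    (ET : List (WalkTree.TEdge H _≺_)) → Unique ET →
    (∀ E → (E ∈ ET) ⇔ WalkTree.IsTEdge H _≺_ v E) →
    (ProbH H v ≡ WalkTree.ProbT H _≺_ ET (v , []))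
    × (WalkTree.ProbT H _≺_ ET (v , []) ≡ WalkTree.rhs H _≺_ ET (v , []))
lemma4p2 H v _≺_ sto ET ET-unique ET-complete = ProbH≡ProbT , ProbT≡rhs
  where
  open WalkTree H _≺_ using (ProbT; tverts; subtree; _∈ᵂ_)
  open Main H v _≺_ sto ET ET-unique ET-complete
  open MatchingCounts _≟V_ members using (Prob)
  open TreeRecursion H _≺_ ET using (Prob-subtree-recursion)
  ProbH≡ProbT : ProbH H v ≡ ProbT ET (v , [])
  ProbH≡ProbT = begin
    ProbH H v                                  ≡⟨ cong (λ es → Prob es v) (sym available-root) ⟩
    Prob (available (v , [])) v                ≡⟨ probs-agree (v , []) (refl , tt) ⟩
    ProbT (subtree ET (v , [])) (v , [])       ≡⟨ cong (λ es → ProbT es (v , [])) subtree-root ⟩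
    ProbT ET (v , [])                          ∎
    where open ≡-Reasoning
  ProbT≡rhs : ProbT ET (v , []) ≡ WalkTree.rhs H _≺_ ET (v , [])
  ProbT≡rhs = subst (λ es → ProbT es (v , []) ≡ inv (1ℚ ℚ.+ sumℚ (map (treeFactor (v , []))
                                                                   (filterᵇ (λ E → (v , []) ∈ᵂ tverts E) es))))
                    subtree-root (Prob-subtree-recursion (v , []))
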